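{- For $n\ge1$ and $k\ge0$, $$\sum_{\sigma\in\mathcal{P}_{n,k}}\alpha^{\mathrm{lmi}(\sigma)-1}\beta^{\mathrm{rmi}(\sigma)-1}=\sum_{\sigma\in\mathcal{L}_{n-1,k}}(\alpha+\beta)^{\mathrm{rmi}(\sigma)},$$ where $\mathcal{P}_{n,k}=\{\sigma\in\mathfrak{S}_n:\widetilde{\mathrm{M}}(\sigma)=k\}$ and $\mathcal{L}_{n-1,k}=\{\sigma\in\mathfrak{S}_{n-1}:\mathrm{M}_0(\sigma)=k\}$. Consequently, if $\gamma_{n,k}(\alpha,\beta)$ are defined by the expansion $$A_n\Big(x,y\,\Big|\,\tfrac{\alpha+\beta}{2},\tfrac{\alpha+\beta}{2}\Big)=\sum_{k=0}^{\lfloor (n-1)/2\rfloor}\gamma_{n,k}(\alpha,\beta)(xy)^k(x+y)^{n-2k-1},$$ then $\gamma_{n,k}(\alpha,\beta)=2^{2k+1-n}\sum_{\sigma\in\mathcal{L}_{n-1,k}}(\alpha+\beta)^{\mathrm{rmi}(\sigma)}$.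
   Context: $\mathfrak{S}_n$ is the set of permutations of $[n]$ ($\mathfrak{S}_0$ contains only the empty permutation). $\mathrm{lmi},\mathrm{rmi}$ count left-to-right minima and right-to-left minima. $\widetilde{\mathrm{M}}(\sigma)$ is the number of $i\in[n]$ with $\sigma_{i-1}<\sigma_i>\sigma_{i+1}$ under the convention $\sigma_0=\sigma_{n+1}=+\infty$; $\mathrm{M}_0(\sigma)$ is the number of such $i$ under the convention $\sigma_0=0$, $\sigma_{n+1}=+\infty$. The Stirling–Eulerian polynomial is $A_n(x,y|\alpha,\beta)=\sum_{\sigma\in\mathfrak{S}_n}x^{\mathrm{asc}(\sigma)}y^{\mathrm{des}(\sigma)}\alpha^{\mathrm{lma}(\sigma)-1}\beta^{\mathrm{rma}(\sigma)-1}$, where $\mathrm{asc},\mathrm{des}$ count indices $i\in[n-1]$ with $\sigma_i<\sigma_{i+1}$, resp. $\sigma_i>\sigma_{i+1}$, and $\mathrm{lma},\mathrm{rma}$ count left-to-right and right-to-left maxima. -}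

module Defs where

open import Data.Bool using (Bool; true; false; if_then_else_; _∧_; not)
open import Data.Nat as ℕ using (ℕ; zero; suc; _∸_; _<ᵇ_; _≡ᵇ_)
open import Data.List using (List; []; _∷_; map; concatMap; filterᵇ; reverse; _++_; foldr; upTo)
open import Data.Maybe using (Maybe; just; nothing)
open import Data.Rational using (ℚ; 0ℚ; 1ℚ; _+_; _*_)

-- Permutations of [n] = {1,…,n}, written in one-line notation σ₁ … σₙ
-- as lists of naturals.  𝔖ₙ is obtained by filtering all words of
-- length n over the alphabet [n] for those with pairwise distinct
-- letters.  𝔖₀ = [ [] ] (only the empty permutation).

range1 : ℕ → List ℕ
range1 n = map suc (upTo n)

words : List ℕ → ℕ → List (List ℕ)
words as zero    = [] ∷ []
words as (suc m) = concatMap (λ a → map (a ∷_) (words as m)) as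

notIn : ℕ → List ℕ → Bool
notIn x []       = true
notIn x (y ∷ ys) = not (x ≡ᵇ y) ∧ notIn x ys

distinct : List ℕ → Bool
distinct []       = true
distinct (x ∷ xs) = notIn x xs ∧ distinct xs

𝔖 : ℕ → List (List ℕ)
𝔖 n = filterᵇ distinct (words (range1 n) n)

asc : List ℕ → ℕ
asc (a ∷ l@(b ∷ _)) = (if a <ᵇ b then 1 else 0) ℕ.+ asc l
asc _ = 0

des : List ℕ → ℕ
des (a ∷ l@(b ∷ _)) = (if b <ᵇ a then 1 else 0) ℕ.+ des l
des _ = 0

-- left-to-right minima / maxima; the Maybe holds the running min/max
-- of the prefix read so far (nothing = empty prefix).
lmiFrom : Maybe ℕ → List ℕ → ℕ
lmiFrom m [] = 0
lmiFrom nothing  (x ∷ xs) = suc (lmiFrom (just x) xs)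
lmiFrom (just m) (x ∷ xs) = if x <ᵇ m then suc (lmiFrom (just x) xs) else lmiFrom (just m) xs

lmaFrom : Maybe ℕ → List ℕ → ℕ
lmaFrom m [] = 0
lmaFrom nothing  (x ∷ xs) = suc (lmaFrom (just x) xs)
lmaFrom (just m) (x ∷ xs) = if m <ᵇ x then suc (lmaFrom (just x) xs) else lmaFrom (just m) xs

lmi lma rmi rma : List ℕ → ℕ
lmi σ = lmiFrom nothing σ
lma σ = lmaFrom nothing σ
rmi σ = lmi (reverse σ)
rma σ = lma (reverse σ)

data ℕ∞ : Set where
  fin : ℕ → ℕ∞
  ∞   : ℕ∞

_<∞_ : ℕ∞ → ℕ∞ → Bool
fin a <∞ fin b = a <ᵇ b
fin a <∞ ∞     = true
∞     <∞ _     = false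

peaksExt : List ℕ∞ → ℕ
peaksExt (a ∷ l@(b ∷ c ∷ _)) = (if (a <∞ b) ∧ (c <∞ b) then 1 else 0) ℕ.+ peaksExt l
peaksExt _ = 0

peaks : ℕ∞ → ℕ∞ → List ℕ → ℕ
peaks left right σ = peaksExt (left ∷ map fin σ ++ right ∷ [])

Mt : List ℕ → ℕ
Mt σ = peaks ∞ ∞ σ

M0 : List ℕ → ℕ
M0 σ = peaks (fin 0) ∞ σ

_^_ : ℚ → ℕ → ℚ
q ^ zero  = 1ℚ
q ^ suc e = q * (q ^ e)

sumℚ : List ℚ → ℚ
sumℚ = foldr _+_ 0ℚ

𝒫 : ℕ → ℕ → List (List ℕ)
𝒫 n k = filterᵇ (λ σ → Mt σ ≡ᵇ k) (𝔖 n)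

ℒ : ℕ → ℕ → List (List ℕ)
ℒ n k = filterᵇ (λ σ → M0 σ ≡ᵇ k) (𝔖 n)

A : ℕ → ℚ → ℚ → ℚ → ℚ → ℚ
A n x y α β = sumℚ (map (λ σ → (x ^ asc σ) * (y ^ des σ) * (α ^ (lma σ ∸ 1)) * (β ^ (rma σ ∸ 1))) (𝔖 n))

-- Both parts insert a new extreme letter into the permutations of 𝔖ₙ.
--
-- Inserting the maximum next to one of the m peaks of τ moves that peak, inserting it at an end only
-- changes the weight (by α or β for M̃, by γ = α+β at the right end for M₀), and inserting it anywhere
-- else creates a peak. Hence for every h : ℕ → ℚ both ∑_{σ∈𝔖ₙ₊₁} h(M̃ σ) α^(lmi σ-1) β^(rmi σ-1) and
-- ∑_{τ∈𝔖ₙ} h(M₀ τ) γ^(rmi τ) arise from the level below by h ↦ (γ+2m) h(m) + (n-2m) h(m+1), so they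
-- agree; h = δ k gives the first identity.
--
-- Inserting the minimum multiplies x^asc y^des c^(lma-1) c^(rma-1) by (c+des) x + (c+asc) y, that is,
-- it applies D = c(x+y) + xy(∂ₓ+∂ᵧ) to the generating polynomial, and with u = (x+y)/2
--   D((xy)^m u^j) = (2c+2m) (xy)^m u^(j+1) + j (xy)^(m+1) u^(j-1),
-- the same recursion with γ = 2c. So A_{n+1}(x,y|c,c) = ∑_{τ∈𝔖ₙ} (2c)^(rmi τ) (xy)^m u^(n-2m), m = M₀ τ,
-- and grouping by m gives the γ-expansion.

module Submission where

open import Defs
open import Algebra.Bundles using (CommutativeRing)
open import Data.Bool using (Bool; true; false; if_then_else_; _∧_; not; T)
open import Data.Bool.Properties using (∧-zeroʳ; T-≡; T-not-≡; T-∧)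
open import Data.Empty using (⊥-elim)
open import Data.List using (List; []; _∷_; map; concatMap; filterᵇ; _++_; upTo; applyUpTo; length; reverse)
open import Data.List.Properties
  using (upTo-∷ʳ; map-++; map-upTo; map-∘; ++-identityʳ; ++-assoc; length-map; length-upTo; filter-notAll; filter-all; filter-++;
         reverse-++; reverse-involutive; reverse-map)
open import Data.List.Relation.Binary.Permutation.Propositional using (↭-sym)
open import Data.List.Relation.Binary.Permutation.Propositional.Properties using (All-resp-↭; ↭-reverse)
open import Data.List.Relation.Unary.All as All using (All; []; _∷_)
import Data.List.Relation.Unary.All.Properties as All
import Data.List.Relation.Unary.Any as Any
open import Data.List.Relation.Unary.Linked using (Linked; []; [-]; _∷_)
open import Data.Maybe using (just; nothing)
open import Data.Nat as ℕ using (ℕ; zero; suc; pred; _<_; _≤_; _∸_; _*_; _<ᵇ_; _≡ᵇ_; ⌊_/2⌋; s≤s; z≤n)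
import Data.Nat.Properties as ℕP
open ℕP using (≡ᵇ⇒≡; ≡⇒≡ᵇ; ≤-trans; <⇒≤; <⇒<ᵇ; <ᵇ⇒<; m≤n⇒m≤1+n; +-suc; m+n∸m≡n; <-cmp)
open import Data.Product using (_×_; _,_; proj₁; proj₂; Σ-syntax)
open import Data.Rational using (ℚ; 0ℚ; 1ℚ; ½; _+_) renaming (_*_ to _*ℚ_)
open import Data.Rational.Properties
  using (+-identityˡ; +-identityʳ; +-assoc; *-zeroˡ; *-zeroʳ; *-identityˡ; *-comm; *-assoc; *-distribˡ-+; +-*-commutativeRing)
open import Data.Rational.Solver using (module +-*-Solver)
open import Data.Unit using (tt)
open import Function using (Equivalence; _∘_)
open import Relation.Binary using (tri<; tri≈; tri>)
open import Relation.Binary.PropositionalEquality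
open import Relation.Nullary using (¬_; contradiction)
open import Relation.Nullary.Decidable using (T?)

open CommutativeRing +-*-commutativeRing using (semiring; commutativeSemiring)
open import Algebra.Properties.Semiring.Mult semiring using (×-homo-+) renaming (_×_ to _×ℚ_)
import Algebra.Properties.Semiring.Exp semiring as Exp
import Algebra.Properties.CommutativeSemiring.Exp commutativeSemiring as CExp

fromℕ : ℕ → ℚ
fromℕ n = n ×ℚ 1ℚ

fromℕ-+ : ∀ m n → fromℕ (m ℕ.+ n) ≡ fromℕ m + fromℕ n
fromℕ-+ m n = ×-homo-+ 1ℚ m n

^≡Exp^ : ∀ q n → q ^ n ≡ q Exp.^ n
^≡Exp^ q zero    = refl
^≡Exp^ q (suc n) = cong (q *ℚ_) (^≡Exp^ q n)

^-+ : ∀ q m n → q ^ (m ℕ.+ n) ≡ q ^ m *ℚ q ^ n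
^-+ q m n = begin
  q ^ (m ℕ.+ n)           ≡⟨ ^≡Exp^ q (m ℕ.+ n) ⟩
  q Exp.^ (m ℕ.+ n)       ≡⟨ Exp.^-homo-* q m n ⟩
  q Exp.^ m *ℚ q Exp.^ n  ≡⟨ sym (cong₂ _*ℚ_ (^≡Exp^ q m) (^≡Exp^ q n)) ⟩
  q ^ m *ℚ q ^ n          ∎
  where open ≡-Reasoning

^-distrib-* : ∀ p q n → (p *ℚ q) ^ n ≡ p ^ n *ℚ q ^ n
^-distrib-* p q n = begin
  (p *ℚ q) ^ n            ≡⟨ ^≡Exp^ (p *ℚ q) n ⟩
  (p *ℚ q) Exp.^ n        ≡⟨ CExp.^-distrib-* p q n ⟩
  p Exp.^ n *ℚ q Exp.^ n  ≡⟨ sym (cong₂ _*ℚ_ (^≡Exp^ p n) (^≡Exp^ q n)) ⟩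
  p ^ n *ℚ q ^ n          ∎
  where open ≡-Reasoning

iverson : Bool → ℕ
iverson b = if b then 1 else 0

≡ᵇ-true⇒≡ : ∀ {m n} → (m ≡ᵇ n) ≡ true → m ≡ n
≡ᵇ-true⇒≡ {m} {n} eq = ≡ᵇ⇒≡ m n (Equivalence.from T-≡ eq)

≢⇒T-not-≡ᵇ : ∀ {a b} → a ≢ b → T (not (a ≡ᵇ b))
≢⇒T-not-≡ᵇ {a} {b} a≢b with a ≡ᵇ b in a≡ᵇb
... | true  = a≢b (≡ᵇ-true⇒≡ a≡ᵇb)
... | false = tt

<ᵇ≡true : ∀ {m n} → m < n → (m <ᵇ n) ≡ true
<ᵇ≡true m<n = Equivalence.to T-≡ (<⇒<ᵇ m<n)

<ᵇ≡false : ∀ {m n} → n ≤ m → (m <ᵇ n) ≡ false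
<ᵇ≡false {m} {n} n≤m with m <ᵇ n in m<ᵇn
... | false = refl
... | true  = ⊥-elim (ℕP.<⇒≱ (<ᵇ⇒< m n (Equivalence.from T-≡ m<ᵇn)) n≤m)

<ᵇ-flip : ∀ {a b} → a ≢ b → (a <ᵇ b) ≡ not (b <ᵇ a)
<ᵇ-flip {a} {b} a≢b with <-cmp a b
... | tri< a<b _ _ rewrite <ᵇ≡true a<b | <ᵇ≡false {b} {a} (<⇒≤ a<b) = refl
... | tri≈ _ a≡b _ = contradiction a≡b a≢b
... | tri> _ _ b<a rewrite <ᵇ≡true b<a | <ᵇ≡false {a} {b} (<⇒≤ b<a) = refl

∑ : {A : Set} → List A → (A → ℚ) → ℚ
∑ xs f = sumℚ (map f xs)

syntax ∑ xs (λ x → e) = ∑[ x ∈ xs ] e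

module _ {A : Set} where

  ∑-cong : (xs : List A) {f g : A → ℚ} → (∀ x → f x ≡ g x) → ∑ xs f ≡ ∑ xs g
  ∑-cong []       f≗g = refl
  ∑-cong (x ∷ xs) f≗g = cong₂ _+_ (f≗g x) (∑-cong xs f≗g)

  ∑-cong-All : {xs : List A} {f g : A → ℚ} → All (λ x → f x ≡ g x) xs → ∑ xs f ≡ ∑ xs g
  ∑-cong-All []           = refl
  ∑-cong-All (fx≡gx ∷ eqs) = cong₂ _+_ fx≡gx (∑-cong-All eqs)

  ∑-0 : (xs : List A) → ∑[ x ∈ xs ] 0ℚ ≡ 0ℚ
  ∑-0 []       = refl
  ∑-0 (x ∷ xs) = trans (+-identityˡ _) (∑-0 xs)

  ∑-++ : (xs ys : List A) (f : A → ℚ) → ∑ (xs ++ ys) f ≡ ∑ xs f + ∑ ys f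
  ∑-++ []       ys f = sym (+-identityˡ _)
  ∑-++ (x ∷ xs) ys f = trans (cong (f x +_) (∑-++ xs ys f)) (sym (+-assoc (f x) _ _))

  ∑-+ : (xs : List A) (f g : A → ℚ) → ∑[ x ∈ xs ] (f x + g x) ≡ ∑ xs f + ∑ xs g
  ∑-+ []       f g = sym (+-identityˡ 0ℚ)
  ∑-+ (x ∷ xs) f g = trans (cong (f x + g x +_) (∑-+ xs f g))
    (solve 4 (λ a b c d → (a :+ b) :+ (c :+ d) := (a :+ c) :+ (b :+ d)) refl (f x) (g x) (∑ xs f) (∑ xs g))
    where open +-*-Solver

  ∑-*ˡ : (xs : List A) (c : ℚ) (f : A → ℚ) → ∑[ x ∈ xs ] (c *ℚ f x) ≡ c *ℚ ∑ xs f
  ∑-*ˡ []       c f = sym (*-zeroʳ c)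
  ∑-*ˡ (x ∷ xs) c f = trans (cong (c *ℚ f x +_) (∑-*ˡ xs c f)) (sym (*-distribˡ-+ c (f x) _))

  ∑-filterᵇ : (p : A → Bool) (xs : List A) (f : A → ℚ) →
              ∑ (filterᵇ p xs) f ≡ ∑[ x ∈ xs ] (if p x then f x else 0ℚ)
  ∑-filterᵇ p []       f = refl
  ∑-filterᵇ p (x ∷ xs) f with p x
  ... | true  = cong (f x +_) (∑-filterᵇ p xs f)
  ... | false = trans (∑-filterᵇ p xs f) (sym (+-identityˡ _))

∑-*ʳ : {A : Set} (xs : List A) (f : A → ℚ) (c : ℚ) → ∑[ x ∈ xs ] (f x *ℚ c) ≡ ∑ xs f *ℚ c
∑-*ʳ xs f c = trans (∑-cong xs (λ x → *-comm (f x) c)) (trans (∑-*ˡ xs c f) (*-comm c (∑ xs f)))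

module _ {A B : Set} where

  ∑-map : (g : A → B) (xs : List A) (f : B → ℚ) → ∑ (map g xs) f ≡ ∑[ x ∈ xs ] f (g x)
  ∑-map g []       f = refl
  ∑-map g (x ∷ xs) f = cong (f (g x) +_) (∑-map g xs f)

  ∑-concatMap : (g : A → List B) (xs : List A) (f : B → ℚ) →
                ∑ (concatMap g xs) f ≡ ∑[ x ∈ xs ] ∑ (g x) f
  ∑-concatMap g []       f = refl
  ∑-concatMap g (x ∷ xs) f =
    trans (∑-++ (g x) (concatMap g xs) f) (cong (∑ (g x) f +_) (∑-concatMap g xs f))

  ∑-comm : (xs : List A) (ys : List B) (f : A → B → ℚ) →
           ∑[ x ∈ xs ] ∑[ y ∈ ys ] f x y ≡ ∑[ y ∈ ys ] ∑[ x ∈ xs ] f x y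
  ∑-comm []       ys f = sym (∑-0 ys)
  ∑-comm (x ∷ xs) ys f =
    trans (cong (∑ ys (f x) +_) (∑-comm xs ys f)) (sym (∑-+ ys (f x) (λ y → ∑[ x ∈ xs ] f x y)))

∑-upTo-indicator : ∀ {B s} (g : ℕ → ℚ) → s < B →
                   ∑[ k ∈ upTo B ] (if s ≡ᵇ k then g k else 0ℚ) ≡ g s
∑-upTo-indicator {suc B} {zero} g _ = begin
  g 0 + ∑[ k ∈ applyUpTo suc B ] (if 0 ≡ᵇ k then g k else 0ℚ)  ≡⟨ cong (λ ks → g 0 + ∑ ks _) (sym (map-upTo suc B)) ⟩
  g 0 + ∑[ k ∈ map suc (upTo B) ] (if 0 ≡ᵇ k then g k else 0ℚ) ≡⟨ cong (g 0 +_) (trans (∑-map suc (upTo B) _) (∑-0 (upTo B))) ⟩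
  g 0 + 0ℚ  ≡⟨ +-identityʳ (g 0) ⟩
  g 0       ∎
  where open ≡-Reasoning
∑-upTo-indicator {suc B} {suc s} g (s≤s s<B) = begin
  0ℚ + ∑[ k ∈ applyUpTo suc B ] (if suc s ≡ᵇ k then g k else 0ℚ)  ≡⟨ +-identityˡ _ ⟩
  ∑[ k ∈ applyUpTo suc B ] (if suc s ≡ᵇ k then g k else 0ℚ)       ≡⟨ cong (λ ks → ∑ ks _) (sym (map-upTo suc B)) ⟩
  ∑[ k ∈ map suc (upTo B) ] (if suc s ≡ᵇ k then g k else 0ℚ)      ≡⟨ ∑-map suc (upTo B) _ ⟩
  ∑[ k ∈ upTo B ] (if s ≡ᵇ k then g (suc k) else 0ℚ)              ≡⟨ ∑-upTo-indicator (λ k → g (suc k)) s<B ⟩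
  g (suc s)                                                       ∎
  where open ≡-Reasoning

*-if : ∀ (q u : ℚ) b → q *ℚ (if b then u else 0ℚ) ≡ (if b then q *ℚ u else 0ℚ)
*-if q u true  = refl
*-if q u false = *-zeroʳ q

δ : ℕ → ℕ → ℚ
δ k v = if v ≡ᵇ k then 1ℚ else 0ℚ

∑-filter-≡ᵇ : {A : Set} (s : A → ℕ) (k : ℕ) (xs : List A) (f : A → ℚ) →
  ∑ (filterᵇ (λ x → s x ≡ᵇ k) xs) f ≡ ∑[ x ∈ xs ] (δ k (s x) *ℚ f x)
∑-filter-≡ᵇ s k xs f = trans (∑-filterᵇ _ xs f) (∑-cong xs (λ x → if-as-δ (s x ≡ᵇ k) (f x)))
  where
  if-as-δ : ∀ b u → (if b then u else 0ℚ) ≡ (if b then 1ℚ else 0ℚ) *ℚ u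
  if-as-δ true  u = sym (*-identityˡ u)
  if-as-δ false u = sym (*-zeroˡ u)

∑-groupBy : {A : Set} (s : A → ℕ) (B : ℕ) (xs : List A) (f : A → ℚ) (Ψ : ℕ → ℚ) → All (λ x → s x < B) xs →
  ∑[ x ∈ xs ] (Ψ (s x) *ℚ f x) ≡ ∑[ k ∈ upTo B ] (Ψ k *ℚ ∑ (filterᵇ (λ x → s x ≡ᵇ k) xs) f)
∑-groupBy s B xs f Ψ s<B = sym (begin
  ∑[ k ∈ upTo B ] (Ψ k *ℚ ∑ (filterᵇ (λ x → s x ≡ᵇ k) xs) f)
    ≡⟨ ∑-cong (upTo B) (λ k → trans (cong (Ψ k *ℚ_) (∑-filterᵇ _ xs f)) (sym (∑-*ˡ xs (Ψ k) _))) ⟩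
  ∑[ k ∈ upTo B ] ∑[ x ∈ xs ] (Ψ k *ℚ (if s x ≡ᵇ k then f x else 0ℚ))
    ≡⟨ ∑-cong (upTo B) (λ k → ∑-cong xs (λ x → *-if (Ψ k) (f x) (s x ≡ᵇ k))) ⟩
  ∑[ k ∈ upTo B ] ∑[ x ∈ xs ] (if s x ≡ᵇ k then Ψ k *ℚ f x else 0ℚ)
    ≡⟨ ∑-comm (upTo B) xs _ ⟩
  ∑[ x ∈ xs ] ∑[ k ∈ upTo B ] (if s x ≡ᵇ k then Ψ k *ℚ f x else 0ℚ)
    ≡⟨ ∑-cong-All (All.map (∑-upTo-indicator (λ k → Ψ k *ℚ f _)) s<B) ⟩
  ∑[ x ∈ xs ] (Ψ (s x) *ℚ f x) ∎)
  where open ≡-Reasoning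

distinctWords : List ℕ → ℕ → List (List ℕ)
distinctWords as m = filterᵇ distinct (words as m)

delete : ℕ → List ℕ → List ℕ
delete a = filterᵇ (λ b → not (a ≡ᵇ b))

occurrences : ℕ → List ℕ → ℕ
occurrences a []       = 0
occurrences a (b ∷ bs) = iverson (a ≡ᵇ b) ℕ.+ occurrences a bs

insertions : ℕ → List ℕ → List (List ℕ)
insertions N []      = (N ∷ []) ∷ []
insertions N (a ∷ τ) = (N ∷ a ∷ τ) ∷ map (a ∷_) (insertions N τ)

laterInsertions : ℕ → List ℕ → List (List ℕ)
laterInsertions N []      = []
laterInsertions N (a ∷ τ) = map (a ∷_) (insertions N τ)

∑-insertions : ∀ N τ (f : List ℕ → ℚ) → ∑ (insertions N τ) f ≡ f (N ∷ τ) + ∑ (laterInsertions N τ) f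
∑-insertions N []      f = refl
∑-insertions N (a ∷ τ) f = refl

∑-words-notIn : ∀ a as m (f : List ℕ → ℚ) →
  ∑[ w ∈ words as m ] (if notIn a w then f w else 0ℚ) ≡ ∑ (words (delete a as) m) f
∑-words-notIn a as zero    f = refl
∑-words-notIn a as (suc m) f = begin
  ∑ (concatMap (λ b → map (b ∷_) (words as m)) as) F
    ≡⟨ ∑-concatMap _ as F ⟩
  ∑[ b ∈ as ] ∑ (map (b ∷_) (words as m)) F
    ≡⟨ ∑-cong as (λ b → trans (∑-map (b ∷_) (words as m) F) (firstLetter b)) ⟩
  ∑[ b ∈ as ] (if not (a ≡ᵇ b) then ∑[ w ∈ words (delete a as) m ] f (b ∷ w) else 0ℚ)
    ≡⟨ sym (∑-filterᵇ _ as _) ⟩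
  ∑[ b ∈ delete a as ] ∑[ w ∈ words (delete a as) m ] f (b ∷ w)
    ≡⟨ sym (∑-cong (delete a as) (λ b → ∑-map (b ∷_) (words (delete a as) m) f)) ⟩
  ∑[ b ∈ delete a as ] ∑ (map (b ∷_) (words (delete a as) m)) f
    ≡⟨ sym (∑-concatMap _ (delete a as) f) ⟩
  ∑ (words (delete a as) (suc m)) f ∎
  where
  open ≡-Reasoning
  F : List ℕ → ℚ
  F w = if notIn a w then f w else 0ℚ
  firstLetter : ∀ b → ∑[ w ∈ words as m ] F (b ∷ w)
                    ≡ (if not (a ≡ᵇ b) then ∑[ w ∈ words (delete a as) m ] f (b ∷ w) else 0ℚ)
  firstLetter b with a ≡ᵇ b
  ... | true  = ∑-0 (words as m)
  ... | false = ∑-words-notIn a as m (λ w → f (b ∷ w))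

∑-distinctWords-suc : ∀ as m (f : List ℕ → ℚ) →
  ∑ (distinctWords as (suc m)) f ≡ ∑[ a ∈ as ] ∑[ τ ∈ distinctWords (delete a as) m ] f (a ∷ τ)
∑-distinctWords-suc as m f = begin
  ∑ (distinctWords as (suc m)) f
    ≡⟨ ∑-filterᵇ distinct (words as (suc m)) f ⟩
  ∑ (concatMap (λ b → map (b ∷_) (words as m)) as) F
    ≡⟨ ∑-concatMap _ as F ⟩
  ∑[ a ∈ as ] ∑ (map (a ∷_) (words as m)) F
    ≡⟨ ∑-cong as (λ a → trans (∑-map (a ∷_) (words as m) F) (firstLetter a)) ⟩
  ∑[ a ∈ as ] ∑[ τ ∈ distinctWords (delete a as) m ] f (a ∷ τ) ∎
  where
  open ≡-Reasoning
  F : List ℕ → ℚ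
  F w = if distinct w then f w else 0ℚ
  firstLetter : ∀ a → ∑[ w ∈ words as m ] F (a ∷ w) ≡ ∑[ τ ∈ distinctWords (delete a as) m ] f (a ∷ τ)
  firstLetter a = begin
    ∑[ w ∈ words as m ] F (a ∷ w)
      ≡⟨ ∑-cong (words as m) split∧ ⟩
    ∑[ w ∈ words as m ] (if notIn a w then (if distinct w then f (a ∷ w) else 0ℚ) else 0ℚ)
      ≡⟨ ∑-words-notIn a as m _ ⟩
    ∑[ w ∈ words (delete a as) m ] (if distinct w then f (a ∷ w) else 0ℚ)
      ≡⟨ sym (∑-filterᵇ distinct (words (delete a as) m) _) ⟩
    ∑[ τ ∈ distinctWords (delete a as) m ] f (a ∷ τ) ∎
    where
    split∧ : ∀ w → F (a ∷ w) ≡ (if notIn a w then (if distinct w then f (a ∷ w) else 0ℚ) else 0ℚ)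
    split∧ w with notIn a w
    ... | true  = refl
    ... | false = refl

∑-occurrences : ∀ a as (h : ℕ → ℚ) → ∑ as h ≡ fromℕ (occurrences a as) *ℚ h a + ∑ (delete a as) h
∑-occurrences a []       h = solve 1 (λ x → con 0ℚ := con 0ℚ :* x :+ con 0ℚ) refl (h a)
  where open +-*-Solver
∑-occurrences a (b ∷ bs) h with a ≡ᵇ b in a≡ᵇb
... | false = trans (cong (h b +_) (∑-occurrences a bs h))
  (solve 3 (λ x y z → x :+ (y :+ z) := y :+ (x :+ z)) refl (h b) (fromℕ (occurrences a bs) *ℚ h a) (∑ (delete a bs) h))
  where open +-*-Solver
... | true with refl ← ≡ᵇ-true⇒≡ {a} {b} a≡ᵇb = trans (cong (h b +_) (∑-occurrences b bs h))
  (solve 3 (λ x y z → x :+ (y :* x :+ z) := (con 1ℚ :+ y) :* x :+ z) refl (h b) (fromℕ (occurrences b bs)) (∑ (delete b bs) h))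
  where open +-*-Solver

delete-comm : ∀ a b as → delete a (delete b as) ≡ delete b (delete a as)
delete-comm a b []       = refl
delete-comm a b (c ∷ cs) with b ≡ᵇ c in b≡ᵇc | a ≡ᵇ c in a≡ᵇc
... | true  | true                  = delete-comm a b cs
... | true  | false rewrite b≡ᵇc    = delete-comm a b cs
... | false | true  rewrite a≡ᵇc    = delete-comm a b cs
... | false | false rewrite b≡ᵇc | a≡ᵇc = cong (c ∷_) (delete-comm a b cs)

occurrences-delete : ∀ a b as → (a ≡ᵇ b) ≡ false → occurrences a (delete b as) ≡ occurrences a as
occurrences-delete a b []       a≢b = refl
occurrences-delete a b (c ∷ cs) a≢b with b ≡ᵇ c in b≡ᵇc
... | false = cong (_ ℕ.+_) (occurrences-delete a b cs a≢b)
... | true with refl ← ≡ᵇ-true⇒≡ {b} {c} b≡ᵇc rewrite a≢b = occurrences-delete a b cs a≢b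

∑-laterInsertions-suc : ∀ bs m M (f : List ℕ → ℚ) →
  ∑[ τ ∈ distinctWords bs (suc m) ] ∑ (laterInsertions M τ) f
    ≡ ∑[ a ∈ bs ] ∑[ τ ∈ distinctWords (delete a bs) m ] ∑[ σ ∈ insertions M τ ] f (a ∷ σ)
∑-laterInsertions-suc bs m M f = trans (∑-distinctWords-suc bs m _)
  (∑-cong bs (λ a → ∑-cong (distinctWords (delete a bs) m) (λ τ → ∑-map (a ∷_) (insertions M τ) f)))

mutual
  ∑-distinctWords-insert : ∀ m as M → occurrences M as ≡ 1 → (f : List ℕ → ℚ) →
    ∑ (distinctWords as (suc m)) f
      ≡ ∑ (distinctWords (delete M as) (suc m)) f + ∑[ τ ∈ distinctWords (delete M as) m ] ∑ (insertions M τ) f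
  ∑-distinctWords-insert m as M once f = begin
    ∑ (distinctWords as (suc m)) f
      ≡⟨ ∑-distinctWords-suc as m f ⟩
    ∑ as H
      ≡⟨ ∑-occurrences M as H ⟩
    fromℕ (occurrences M as) *ℚ H M + ∑ (delete M as) H
      ≡⟨ cong (λ k → fromℕ k *ℚ H M + ∑ (delete M as) H) once ⟩
    (1ℚ + 0ℚ) *ℚ H M + ∑ (delete M as) H
      ≡⟨ cong (_+ ∑ (delete M as) H) (solve 1 (λ x → (con 1ℚ :+ con 0ℚ) :* x := x) refl (H M)) ⟩
    H M + ∑ (delete M as) H
      ≡⟨ cong (H M +_) (∑-otherFirstLetters m as M once f) ⟩
    H M + (∑ (delete M as) H′ + L)
      ≡⟨ solve 3 (λ x y z → x :+ (y :+ z) := y :+ (x :+ z)) refl (H M) (∑ (delete M as) H′) L ⟩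
    ∑ (delete M as) H′ + (H M + L)
      ≡⟨ cong₂ _+_ (sym (∑-distinctWords-suc (delete M as) m f)) (sym (∑-+ (distinctWords (delete M as) m) _ _)) ⟩
    ∑ (distinctWords (delete M as) (suc m)) f + ∑[ τ ∈ distinctWords (delete M as) m ] (f (M ∷ τ) + ∑ (laterInsertions M τ) f)
      ≡⟨ cong (∑ (distinctWords (delete M as) (suc m)) f +_) (∑-cong (distinctWords (delete M as) m) (λ τ → sym (∑-insertions M τ f))) ⟩
    ∑ (distinctWords (delete M as) (suc m)) f + ∑[ τ ∈ distinctWords (delete M as) m ] ∑ (insertions M τ) f ∎
    where
    open ≡-Reasoning
    open +-*-Solver
    H H′ : ℕ → ℚ
    H  a = ∑[ τ ∈ distinctWords (delete a as) m ] f (a ∷ τ)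
    H′ a = ∑[ τ ∈ distinctWords (delete a (delete M as)) m ] f (a ∷ τ)
    L : ℚ
    L = ∑[ τ ∈ distinctWords (delete M as) m ] ∑ (laterInsertions M τ) f

  ∑-otherFirstLetters : ∀ m as M → occurrences M as ≡ 1 → (f : List ℕ → ℚ) →
    ∑[ a ∈ delete M as ] ∑[ τ ∈ distinctWords (delete a as) m ] f (a ∷ τ)
      ≡ ∑[ a ∈ delete M as ] ∑[ τ ∈ distinctWords (delete a (delete M as)) m ] f (a ∷ τ)
        + ∑[ τ ∈ distinctWords (delete M as) m ] ∑ (laterInsertions M τ) f
  ∑-otherFirstLetters zero as M once f = begin
    ∑[ a ∈ delete M as ] (f (a ∷ []) + 0ℚ)
      ≡⟨ sym (+-identityʳ _) ⟩
    ∑[ a ∈ delete M as ] (f (a ∷ []) + 0ℚ) + 0ℚ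
      ≡⟨ cong (∑[ a ∈ delete M as ] (f (a ∷ []) + 0ℚ) +_) (sym (+-identityʳ 0ℚ)) ⟩
    ∑[ a ∈ delete M as ] (f (a ∷ []) + 0ℚ) + (0ℚ + 0ℚ) ∎
    where open ≡-Reasoning
  ∑-otherFirstLetters (suc m) as M once f = begin
    ∑[ a ∈ delete M as ] ∑[ τ ∈ distinctWords (delete a as) (suc m) ] f (a ∷ τ)
      ≡⟨ ∑-cong-All (All.map (λ {a} a≢M → splitAt a (Equivalence.to T-not-≡ a≢M)) (All.all-filter _ as)) ⟩
    ∑[ a ∈ delete M as ] (∑[ τ ∈ distinctWords (delete a (delete M as)) (suc m) ] f (a ∷ τ)
                          + ∑[ τ ∈ distinctWords (delete a (delete M as)) m ] ∑[ σ ∈ insertions M τ ] f (a ∷ σ))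
      ≡⟨ ∑-+ (delete M as) _ _ ⟩
    ∑[ a ∈ delete M as ] ∑[ τ ∈ distinctWords (delete a (delete M as)) (suc m) ] f (a ∷ τ)
      + ∑[ a ∈ delete M as ] ∑[ τ ∈ distinctWords (delete a (delete M as)) m ] ∑[ σ ∈ insertions M τ ] f (a ∷ σ)
      ≡⟨ cong (∑[ a ∈ delete M as ] ∑[ τ ∈ distinctWords (delete a (delete M as)) (suc m) ] f (a ∷ τ) +_)
              (sym (∑-laterInsertions-suc (delete M as) m M f)) ⟩
    ∑[ a ∈ delete M as ] ∑[ τ ∈ distinctWords (delete a (delete M as)) (suc m) ] f (a ∷ τ)
      + ∑[ τ ∈ distinctWords (delete M as) (suc m) ] ∑ (laterInsertions M τ) f ∎
    where
    open ≡-Reasoning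
    splitAt : ∀ a → (M ≡ᵇ a) ≡ false →
      ∑[ τ ∈ distinctWords (delete a as) (suc m) ] f (a ∷ τ)
        ≡ ∑[ τ ∈ distinctWords (delete a (delete M as)) (suc m) ] f (a ∷ τ)
          + ∑[ τ ∈ distinctWords (delete a (delete M as)) m ] ∑[ σ ∈ insertions M τ ] f (a ∷ σ)
    splitAt a M≢a rewrite delete-comm a M as =
      ∑-distinctWords-insert m (delete a as) M (trans (occurrences-delete M a as M≢a) once) (λ σ → f (a ∷ σ))

delete-shortens : ∀ as → All (λ a → length (delete a as) < length as) as
delete-shortens as = All.tabulate (λ a∈as → filter-notAll _ as (Any.map notKept a∈as))
  where
  notKept : ∀ {a b} → a ≡ b → ¬ T (not (a ≡ᵇ b))
  notKept {a} refl kept = subst T (Equivalence.to T-not-≡ kept) (≡⇒≡ᵇ a a refl)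

∑-distinctWords-long : ∀ m as → length as < m → (f : List ℕ → ℚ) → ∑ (distinctWords as m) f ≡ 0ℚ
∑-distinctWords-long (suc m) as (s≤s |as|≤m) f = begin
  ∑ (distinctWords as (suc m)) f
    ≡⟨ ∑-distinctWords-suc as m f ⟩
  ∑[ a ∈ as ] ∑[ τ ∈ distinctWords (delete a as) m ] f (a ∷ τ)
    ≡⟨ ∑-cong-All (All.map (λ {a} shorter → ∑-distinctWords-long m (delete a as) (≤-trans shorter |as|≤m) _) (delete-shortens as)) ⟩
  ∑[ a ∈ as ] 0ℚ
    ≡⟨ ∑-0 as ⟩
  0ℚ ∎
  where open ≡-Reasoning

occurrences-none : ∀ {a xs} → All (λ x → T (not (a ≡ᵇ x))) xs → occurrences a xs ≡ 0
occurrences-none []                        = refl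
occurrences-none {a} {x ∷ xs} (a≢x ∷ a∉xs) rewrite Equivalence.to T-not-≡ a≢x = occurrences-none a∉xs

occurrences-++ : ∀ a xs ys → occurrences a (xs ++ ys) ≡ occurrences a xs ℕ.+ occurrences a ys
occurrences-++ a []       ys = refl
occurrences-++ a (x ∷ xs) ys =
  trans (cong (_ ℕ.+_) (occurrences-++ a xs ys)) (sym (ℕP.+-assoc (iverson (a ≡ᵇ x)) _ _))

occurrences-self : ∀ a → occurrences a (a ∷ []) ≡ 1
occurrences-self a rewrite Equivalence.to T-≡ (≡⇒≡ᵇ a a refl) = refl

delete-self : ∀ a → delete a (a ∷ []) ≡ []
delete-self a rewrite Equivalence.to T-≡ (≡⇒≡ᵇ a a refl) = refl

delete-map-suc : ∀ a as → delete (suc a) (map suc as) ≡ map suc (delete a as)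
delete-map-suc a []       = refl
delete-map-suc a (b ∷ bs) with a ≡ᵇ b
... | true  = delete-map-suc a bs
... | false = cong (suc b ∷_) (delete-map-suc a bs)

∑-distinctWords-map-suc : ∀ m as (f : List ℕ → ℚ) →
  ∑ (distinctWords (map suc as) m) f ≡ ∑[ τ ∈ distinctWords as m ] f (map suc τ)
∑-distinctWords-map-suc zero    as f = refl
∑-distinctWords-map-suc (suc m) as f = begin
  ∑ (distinctWords (map suc as) (suc m)) f
    ≡⟨ ∑-distinctWords-suc (map suc as) m f ⟩
  ∑[ a ∈ map suc as ] ∑[ τ ∈ distinctWords (delete a (map suc as)) m ] f (a ∷ τ)
    ≡⟨ ∑-map suc as _ ⟩
  ∑[ a ∈ as ] ∑[ τ ∈ distinctWords (delete (suc a) (map suc as)) m ] f (suc a ∷ τ)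
    ≡⟨ ∑-cong as (λ a → trans (cong (λ bs → ∑[ τ ∈ distinctWords bs m ] f (suc a ∷ τ)) (delete-map-suc a as))
                              (∑-distinctWords-map-suc m (delete a as) (λ τ → f (suc a ∷ τ)))) ⟩
  ∑[ a ∈ as ] ∑[ τ ∈ distinctWords (delete a as) m ] f (map suc (a ∷ τ))
    ≡⟨ sym (∑-distinctWords-suc as m (λ τ → f (map suc τ))) ⟩
  ∑[ τ ∈ distinctWords as (suc m) ] f (map suc τ) ∎
  where open ≡-Reasoning

insertions-map-suc : ∀ N τ → insertions (suc N) (map suc τ) ≡ map (map suc) (insertions N τ)
insertions-map-suc N []      = refl
insertions-map-suc N (a ∷ τ) = cong ((suc N ∷ suc a ∷ map suc τ) ∷_) (begin
  map (suc a ∷_) (insertions (suc N) (map suc τ))  ≡⟨ cong (map (suc a ∷_)) (insertions-map-suc N τ) ⟩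
  map (suc a ∷_) (map (map suc) (insertions N τ))  ≡⟨ sym (map-∘ (insertions N τ)) ⟩
  map (λ σ → suc a ∷ map suc σ) (insertions N τ)   ≡⟨ map-∘ (insertions N τ) ⟩
  map (map suc) (map (a ∷_) (insertions N τ))      ∎)
  where open ≡-Reasoning

range1-bounded : ∀ n → All (_< suc n) (range1 n)
range1-bounded n = All.map⁺ (All.applyUpTo⁺₁ _ n s≤s)

range1-suc-last : ∀ n → range1 (suc n) ≡ range1 n ++ suc n ∷ []
range1-suc-last n = trans (cong (map suc) (sym (upTo-∷ʳ n))) (map-++ suc (upTo n) (n ∷ []))

range1-suc-first : ∀ n → range1 (suc n) ≡ 1 ∷ map suc (range1 n)
range1-suc-first n = cong (λ xs → 1 ∷ map suc xs) (sym (map-upTo suc n))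

length-range1 : ∀ n → length (range1 n) ≡ n
length-range1 n = trans (length-map suc (upTo n)) (length-upTo n)

∑-𝔖-insertMax : ∀ n (f : List ℕ → ℚ) → ∑ (𝔖 (suc n)) f ≡ ∑[ τ ∈ 𝔖 n ] ∑ (insertions (suc n) τ) f
∑-𝔖-insertMax n f = begin
  ∑ (distinctWords (range1 (suc n)) (suc n)) f
    ≡⟨ ∑-distinctWords-insert n (range1 (suc n)) (suc n) once f ⟩
  ∑ (distinctWords (delete (suc n) (range1 (suc n))) (suc n)) f
    + ∑[ τ ∈ distinctWords (delete (suc n) (range1 (suc n))) n ] ∑ (insertions (suc n) τ) f
    ≡⟨ cong (λ as → ∑ (distinctWords as (suc n)) f + ∑[ τ ∈ distinctWords as n ] ∑ (insertions (suc n) τ) f) rest ⟩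
  ∑ (distinctWords (range1 n) (suc n)) f + ∑[ τ ∈ 𝔖 n ] ∑ (insertions (suc n) τ) f
    ≡⟨ cong (_+ ∑[ τ ∈ 𝔖 n ] ∑ (insertions (suc n) τ) f)
            (∑-distinctWords-long (suc n) (range1 n) (s≤s (ℕP.≤-reflexive (length-range1 n))) f) ⟩
  0ℚ + ∑[ τ ∈ 𝔖 n ] ∑ (insertions (suc n) τ) f
    ≡⟨ +-identityˡ _ ⟩
  ∑[ τ ∈ 𝔖 n ] ∑ (insertions (suc n) τ) f ∎
  where
  open ≡-Reasoning
  fresh : All (λ x → T (not (suc n ≡ᵇ x))) (range1 n)
  fresh = All.map (λ x<1+n → ≢⇒T-not-≡ᵇ (ℕP.>⇒≢ x<1+n)) (range1-bounded n)
  once : occurrences (suc n) (range1 (suc n)) ≡ 1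
  once = begin
    occurrences (suc n) (range1 (suc n))                                 ≡⟨ cong (occurrences (suc n)) (range1-suc-last n) ⟩
    occurrences (suc n) (range1 n ++ suc n ∷ [])                         ≡⟨ occurrences-++ (suc n) (range1 n) (suc n ∷ []) ⟩
    occurrences (suc n) (range1 n) ℕ.+ occurrences (suc n) (suc n ∷ [])  ≡⟨ cong₂ ℕ._+_ (occurrences-none fresh) (occurrences-self (suc n)) ⟩
    1                                                                    ∎
  rest : delete (suc n) (range1 (suc n)) ≡ range1 n
  rest = begin
    delete (suc n) (range1 (suc n))                           ≡⟨ cong (delete (suc n)) (range1-suc-last n) ⟩
    delete (suc n) (range1 n ++ suc n ∷ [])                   ≡⟨ filter-++ _ (range1 n) (suc n ∷ []) ⟩
    delete (suc n) (range1 n) ++ delete (suc n) (suc n ∷ [])  ≡⟨ cong₂ _++_ (filter-all _ fresh) (delete-self (suc n)) ⟩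
    range1 n ++ []                                            ≡⟨ ++-identityʳ (range1 n) ⟩
    range1 n                                                  ∎

∑-𝔖-insertMin : ∀ n (f : List ℕ → ℚ) → ∑ (𝔖 (suc n)) f ≡ ∑[ τ ∈ 𝔖 n ] ∑[ σ ∈ insertions 0 τ ] f (map suc σ)
∑-𝔖-insertMin n f = begin
  ∑ (distinctWords (range1 (suc n)) (suc n)) f
    ≡⟨ ∑-distinctWords-insert n (range1 (suc n)) 1 once f ⟩
  ∑ (distinctWords (delete 1 (range1 (suc n))) (suc n)) f
    + ∑[ τ ∈ distinctWords (delete 1 (range1 (suc n))) n ] ∑ (insertions 1 τ) f
    ≡⟨ cong (λ as → ∑ (distinctWords as (suc n)) f + ∑[ τ ∈ distinctWords as n ] ∑ (insertions 1 τ) f) rest ⟩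
  ∑ (distinctWords (map suc (range1 n)) (suc n)) f
    + ∑[ τ ∈ distinctWords (map suc (range1 n)) n ] ∑ (insertions 1 τ) f
    ≡⟨ cong₂ _+_ (∑-distinctWords-long (suc n) (map suc (range1 n)) short f)
                 (∑-distinctWords-map-suc n (range1 n) (λ τ → ∑ (insertions 1 τ) f)) ⟩
  0ℚ + ∑[ τ ∈ 𝔖 n ] ∑ (insertions 1 (map suc τ)) f
    ≡⟨ +-identityˡ _ ⟩
  ∑[ τ ∈ 𝔖 n ] ∑ (insertions 1 (map suc τ)) f
    ≡⟨ ∑-cong (𝔖 n) (λ τ → trans (cong (λ σs → ∑ σs f) (insertions-map-suc 0 τ)) (∑-map (map suc) (insertions 0 τ) f)) ⟩
  ∑[ τ ∈ 𝔖 n ] ∑[ σ ∈ insertions 0 τ ] f (map suc σ) ∎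
  where
  open ≡-Reasoning
  fresh : All (λ x → T (not (1 ≡ᵇ x))) (map suc (range1 n))
  fresh = All.map⁺ (All.map⁺ (All.universal _ (upTo n)))
  once : occurrences 1 (range1 (suc n)) ≡ 1
  once = trans (cong (occurrences 1) (range1-suc-first n)) (cong suc (occurrences-none fresh))
  rest : delete 1 (range1 (suc n)) ≡ map suc (range1 n)
  rest = trans (cong (delete 1) (range1-suc-first n)) (filter-all _ fresh)
  short : length (map suc (range1 n)) < suc n
  short = s≤s (ℕP.≤-reflexive (trans (length-map suc (range1 n)) (length-range1 n)))

record IsPermutation (n : ℕ) (σ : List ℕ) : Set where
  field
    length≡n  : length σ ≡ n
    positive  : All (0 <_) σ
    bounded   : All (_< suc n) σ
    injective : T (distinct σ)

words-All : ∀ {P : ℕ → Set} as m → All P as → All (λ w → length w ≡ m × All P w) (words as m)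
words-All as zero    Pas = (refl , []) ∷ []
words-All as (suc m) Pas = All.concat⁺ (All.map⁺ (All.map
  (λ Pa → All.map⁺ (All.map (λ (len , Pw) → cong suc len , Pa ∷ Pw) (words-All as m Pas))) Pas))

𝔖-IsPermutation : ∀ n → All (IsPermutation n) (𝔖 n)
𝔖-IsPermutation n = All.zipWith permutation
  ( All.filter⁺ (T? ∘ distinct) (words-All (range1 n) n (All.zip (positive , range1-bounded n)))
  , All.all-filter (T? ∘ distinct) (words (range1 n) n))
  where
  positive : All (0 <_) (range1 n)
  positive = All.map⁺ (All.universal (λ _ → s≤s z≤n) (upTo n))
  permutation : ∀ {σ} → (length σ ≡ n × All (λ x → 0 < x × x < suc n) σ) × T (distinct σ) → IsPermutation n σ
  permutation ((len , inRange) , dist) = record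
    { length≡n = len ; positive = All.map proj₁ inRange ; bounded = All.map proj₂ inRange ; injective = dist }

distinct⇒Linked≢ : ∀ σ → T (distinct σ) → Linked _≢_ σ
distinct⇒Linked≢ []          _ = []
distinct⇒Linked≢ (a ∷ [])    _ = [-]
distinct⇒Linked≢ (a ∷ b ∷ σ) d = a≢b ∷ distinct⇒Linked≢ (b ∷ σ) (proj₂ a∉bσ×bσ-distinct)
  where
  a∉bσ×bσ-distinct = Equivalence.to (T-∧ {notIn a (b ∷ σ)} {distinct (b ∷ σ)}) d
  a≢b : a ≢ b
  a≢b a≡b = subst T (Equivalence.to T-not-≡ (proj₁ (Equivalence.to (T-∧ {not (a ℕ.≡ᵇ b)}) (proj₁ a∉bσ×bσ-distinct))))
                    (≡⇒≡ᵇ a b a≡b)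

initialInsertions : ℕ → List ℕ → List (List ℕ)
initialInsertions N []      = []
initialInsertions N (b ∷ τ) = (N ∷ b ∷ τ) ∷ map (b ∷_) (initialInsertions N τ)

innerInsertions : ℕ → List ℕ → List (List ℕ)
innerInsertions N []      = []
innerInsertions N (a ∷ τ) = map (a ∷_) (initialInsertions N τ)

∑-insertions-initial : ∀ N τ (f : List ℕ → ℚ) →
  ∑ (insertions N τ) f ≡ ∑ (initialInsertions N τ) f + f (τ ++ N ∷ [])
∑-insertions-initial N []      f = solve 1 (λ x → x :+ con 0ℚ := con 0ℚ :+ x) refl (f (N ∷ []))
  where open +-*-Solver
∑-insertions-initial N (b ∷ τ) f = begin
  f (N ∷ b ∷ τ) + ∑ (map (b ∷_) (insertions N τ)) f
    ≡⟨ cong (f (N ∷ b ∷ τ) +_) (trans (∑-map (b ∷_) (insertions N τ) f) (∑-insertions-initial N τ (λ ρ → f (b ∷ ρ)))) ⟩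
  f (N ∷ b ∷ τ) + (∑[ ρ ∈ initialInsertions N τ ] f (b ∷ ρ) + f (b ∷ τ ++ N ∷ []))
    ≡⟨ sym (+-assoc (f (N ∷ b ∷ τ)) _ _) ⟩
  f (N ∷ b ∷ τ) + ∑[ ρ ∈ initialInsertions N τ ] f (b ∷ ρ) + f (b ∷ τ ++ N ∷ [])
    ≡⟨ cong (λ s → f (N ∷ b ∷ τ) + s + f (b ∷ τ ++ N ∷ [])) (sym (∑-map (b ∷_) (initialInsertions N τ) f)) ⟩
  ∑ (initialInsertions N (b ∷ τ)) f + f (b ∷ τ ++ N ∷ []) ∎
  where open ≡-Reasoning

∑-insertions-split : ∀ N a τ (f : List ℕ → ℚ) →
  ∑ (insertions N (a ∷ τ)) f ≡ f (N ∷ a ∷ τ) + ∑ (innerInsertions N (a ∷ τ)) f + f (a ∷ τ ++ N ∷ [])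
∑-insertions-split N a τ = ∑-insertions-initial N (a ∷ τ)

record InsertionIn (N : ℕ) (τ σ : List ℕ) : Set where
  field
    left right : List ℕ
    right≢[]   : right ≢ []
    τ≡         : τ ≡ left ++ right
    σ≡         : σ ≡ left ++ N ∷ right

  preserves : {B : Set} (f : List ℕ → B) → f (left ++ N ∷ right) ≡ f (left ++ right) → f σ ≡ f τ
  preserves f eq = trans (cong f σ≡) (trans eq (cong f (sym τ≡)))

initialInsertions-shape : ∀ N τ → All (InsertionIn N τ) (initialInsertions N τ)
initialInsertions-shape N []      = []
initialInsertions-shape N (b ∷ τ) =
  record { left = [] ; right = b ∷ τ ; right≢[] = λ () ; τ≡ = refl ; σ≡ = refl }
  ∷ All.map⁺ (All.map extend (initialInsertions-shape N τ))
  where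
  extend : ∀ {ρ} → InsertionIn N τ ρ → InsertionIn N (b ∷ τ) (b ∷ ρ)
  extend i = record { left = b ∷ left ; right = right ; right≢[] = right≢[] ; τ≡ = cong (b ∷_) τ≡ ; σ≡ = cong (b ∷_) σ≡ }
    where open InsertionIn i

All-reverse : ∀ {P : ℕ → Set} {xs} → All P xs → All P (reverse xs)
All-reverse {xs = xs} = All-resp-↭ (↭-sym (↭-reverse xs))

reverse-≢[] : ∀ {xs : List ℕ} → xs ≢ [] → reverse xs ≢ []
reverse-≢[] {xs} xs≢[] rev≡[] = xs≢[] (trans (sym (reverse-involutive xs)) (cong reverse rev≡[]))

reverse-insert : ∀ u (N : ℕ) v → reverse (u ++ N ∷ v) ≡ reverse v ++ N ∷ reverse u
reverse-insert u N v = begin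
  reverse (u ++ N ∷ v)                ≡⟨ reverse-++ u (N ∷ v) ⟩
  reverse (N ∷ v) ++ reverse u        ≡⟨ cong (_++ reverse u) (reverse-++ (N ∷ []) v) ⟩
  (reverse v ++ N ∷ []) ++ reverse u  ≡⟨ ++-assoc (reverse v) (N ∷ []) (reverse u) ⟩
  reverse v ++ N ∷ reverse u          ∎
  where open ≡-Reasoning

module _ {N : ℕ} where

  lmiFrom-insert-max : ∀ c p r → c < N → All (_< N) p → lmiFrom (just c) (p ++ N ∷ r) ≡ lmiFrom (just c) (p ++ r)
  lmiFrom-insert-max c []      r c<N []           rewrite <ᵇ≡false {N} {c} (<⇒≤ c<N) = refl
  lmiFrom-insert-max c (x ∷ p) r c<N (x<N ∷ p<N) with x <ᵇ c
  ... | true  = cong suc (lmiFrom-insert-max x p r x<N p<N)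
  ... | false = lmiFrom-insert-max c p r c<N p<N

  lmi-insert-max : ∀ u v → All (_< N) u → u ≢ [] → lmi (u ++ N ∷ v) ≡ lmi (u ++ v)
  lmi-insert-max []      v _            []≢[] = ⊥-elim ([]≢[] refl)
  lmi-insert-max (a ∷ p) v (a<N ∷ p<N) _     = cong suc (lmiFrom-insert-max a p v a<N p<N)

  lmi-cons-max : ∀ τ → All (_< N) τ → lmi (N ∷ τ) ≡ suc (lmi τ)
  lmi-cons-max []      _         = refl
  lmi-cons-max (a ∷ τ) (a<N ∷ _) rewrite <ᵇ≡true a<N = refl

  lmi-snoc-max : ∀ τ → All (_< N) τ → τ ≢ [] → lmi (τ ++ N ∷ []) ≡ lmi τ
  lmi-snoc-max τ τ<N τ≢[] = trans (lmi-insert-max τ [] τ<N τ≢[]) (cong lmi (++-identityʳ τ))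

  rmi-insert-max : ∀ u v → All (_< N) v → v ≢ [] → rmi (u ++ N ∷ v) ≡ rmi (u ++ v)
  rmi-insert-max u v v<N v≢[] = begin
    lmi (reverse (u ++ N ∷ v))        ≡⟨ cong lmi (reverse-insert u N v) ⟩
    lmi (reverse v ++ N ∷ reverse u)  ≡⟨ lmi-insert-max (reverse v) (reverse u) (All-reverse v<N) (reverse-≢[] v≢[]) ⟩
    lmi (reverse v ++ reverse u)      ≡⟨ cong lmi (sym (reverse-++ u v)) ⟩
    lmi (reverse (u ++ v))            ∎
    where open ≡-Reasoning

  rmi-cons-max : ∀ τ → All (_< N) τ → τ ≢ [] → rmi (N ∷ τ) ≡ rmi τ
  rmi-cons-max = rmi-insert-max []

  rmi-snoc-max : ∀ τ → All (_< N) τ → rmi (τ ++ N ∷ []) ≡ suc (rmi τ)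
  rmi-snoc-max τ τ<N = trans (cong lmi (reverse-++ τ (N ∷ []))) (lmi-cons-max (reverse τ) (All-reverse τ<N))

lmaFrom-insert-min : ∀ c p r → lmaFrom (just c) (p ++ 0 ∷ r) ≡ lmaFrom (just c) (p ++ r)
lmaFrom-insert-min c []      r = refl
lmaFrom-insert-min c (x ∷ p) r with c <ᵇ x
... | true  = cong suc (lmaFrom-insert-min x p r)
... | false = lmaFrom-insert-min c p r

lma-insert-min : ∀ u v → u ≢ [] → lma (u ++ 0 ∷ v) ≡ lma (u ++ v)
lma-insert-min []      v []≢[] = ⊥-elim ([]≢[] refl)
lma-insert-min (a ∷ p) v _     = cong suc (lmaFrom-insert-min a p v)

lma-cons-min : ∀ τ → All (0 <_) τ → lma (0 ∷ τ) ≡ suc (lma τ)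
lma-cons-min []          _             = refl
lma-cons-min (suc a ∷ τ) (s≤s z≤n ∷ _) = refl

lma-snoc-min : ∀ τ → τ ≢ [] → lma (τ ++ 0 ∷ []) ≡ lma τ
lma-snoc-min τ τ≢[] = trans (lma-insert-min τ [] τ≢[]) (cong lma (++-identityʳ τ))

rma-insert-min : ∀ u v → v ≢ [] → rma (u ++ 0 ∷ v) ≡ rma (u ++ v)
rma-insert-min u v v≢[] = begin
  lma (reverse (u ++ 0 ∷ v))        ≡⟨ cong lma (reverse-insert u 0 v) ⟩
  lma (reverse v ++ 0 ∷ reverse u)  ≡⟨ lma-insert-min (reverse v) (reverse u) (reverse-≢[] v≢[]) ⟩
  lma (reverse v ++ reverse u)      ≡⟨ cong lma (sym (reverse-++ u v)) ⟩
  lma (reverse (u ++ v))            ∎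
  where open ≡-Reasoning

rma-cons-min : ∀ τ → τ ≢ [] → rma (0 ∷ τ) ≡ rma τ
rma-cons-min = rma-insert-min []

rma-snoc-min : ∀ τ → All (0 <_) τ → rma (τ ++ 0 ∷ []) ≡ suc (rma τ)
rma-snoc-min τ τ>0 = trans (cong lma (reverse-++ τ (0 ∷ []))) (lma-cons-min (reverse τ) (All-reverse τ>0))

innerInsertions-lmi-rmi : ∀ {N} a τ → All (_< N) (a ∷ τ) →
  All (λ σ → lmi σ ≡ lmi (a ∷ τ) × rmi σ ≡ rmi (a ∷ τ)) (innerInsertions N (a ∷ τ))
innerInsertions-lmi-rmi {N} a τ aτ<N = All.map⁺ (All.map records (initialInsertions-shape N τ))
  where
  records : ∀ {ρ} → InsertionIn N τ ρ → lmi (a ∷ ρ) ≡ lmi (a ∷ τ) × rmi (a ∷ ρ) ≡ rmi (a ∷ τ)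
  records i = preserves (lmi ∘ (a ∷_)) (lmi-insert-max (a ∷ left) right (All.++⁻ˡ (a ∷ left) aτ<N′) (λ ()))
            , preserves (rmi ∘ (a ∷_)) (rmi-insert-max (a ∷ left) right (All.++⁻ʳ (a ∷ left) aτ<N′) right≢[])
    where
    open InsertionIn i
    aτ<N′ : All (_< N) (a ∷ left ++ right)
    aτ<N′ = subst (All (_< N)) (cong (a ∷_) τ≡) aτ<N

innerInsertions-lma-rma : ∀ a τ → All (λ σ → lma σ ≡ lma (a ∷ τ) × rma σ ≡ rma (a ∷ τ)) (innerInsertions 0 (a ∷ τ))
innerInsertions-lma-rma a τ = All.map⁺ (All.map records (initialInsertions-shape 0 τ))
  where
  records : ∀ {ρ} → InsertionIn 0 τ ρ → lma (a ∷ ρ) ≡ lma (a ∷ τ) × rma (a ∷ ρ) ≡ rma (a ∷ τ)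
  records i = preserves (lma ∘ (a ∷_)) (lma-insert-min (a ∷ left) right (λ ()))
            , preserves (rma ∘ (a ∷_)) (rma-insert-min (a ∷ left) right right≢[])
    where open InsertionIn i

initialInsertions-rmi : ∀ {N} τ → All (_< N) τ → All (λ σ → rmi σ ≡ rmi τ) (initialInsertions N τ)
initialInsertions-rmi {N} τ τ<N = All.map rmi-kept (initialInsertions-shape N τ)
  where
  rmi-kept : ∀ {σ} → InsertionIn N τ σ → rmi σ ≡ rmi τ
  rmi-kept i = preserves rmi (rmi-insert-max left right (All.++⁻ʳ left (subst (All (_< N)) τ≡ τ<N)) right≢[])
    where open InsertionIn i

lmi-positive : ∀ {xs} → xs ≢ [] → 0 < lmi xs
lmi-positive {[]}    []≢[] = ⊥-elim ([]≢[] refl)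
lmi-positive {x ∷ _} _     = s≤s z≤n

rmi-positive : ∀ {xs} → xs ≢ [] → 0 < rmi xs
rmi-positive xs≢[] = lmi-positive (reverse-≢[] xs≢[])

lma-positive : ∀ {xs} → xs ≢ [] → 0 < lma xs
lma-positive {[]}    []≢[] = ⊥-elim ([]≢[] refl)
lma-positive {x ∷ _} _     = s≤s z≤n

rma-positive : ∀ {xs} → xs ≢ [] → 0 < rma xs
rma-positive xs≢[] = lma-positive (reverse-≢[] xs≢[])

weight : ℚ → ℚ → ℕ → ℕ → ℚ
weight α β l r = α ^ (l ∸ 1) *ℚ β ^ (r ∸ 1)

minimaWeight maximaWeight : ℚ → ℚ → List ℕ → ℚ
minimaWeight α β σ = weight α β (lmi σ) (rmi σ)
maximaWeight α β σ = weight α β (lma σ) (rma σ)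

weight-sucˡ : ∀ α β {l} r → 0 < l → weight α β (suc l) r ≡ α *ℚ weight α β l r
weight-sucˡ α β {suc l} r _ = *-assoc α (α ^ l) (β ^ (r ∸ 1))

weight-sucʳ : ∀ α β l {r} → 0 < r → weight α β l (suc r) ≡ β *ℚ weight α β l r
weight-sucʳ α β l {suc r} _ =
  solve 3 (λ a b c → a :* (b :* c) := b :* (a :* c)) refl (α ^ (l ∸ 1)) β (β ^ r)
  where open +-*-Solver

asc-map-suc : ∀ σ → asc (map suc σ) ≡ asc σ
asc-map-suc []          = refl
asc-map-suc (a ∷ [])    = refl
asc-map-suc (a ∷ b ∷ σ) = cong (iverson (a <ᵇ b) ℕ.+_) (asc-map-suc (b ∷ σ))

des-map-suc : ∀ σ → des (map suc σ) ≡ des σ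
des-map-suc []          = refl
des-map-suc (a ∷ [])    = refl
des-map-suc (a ∷ b ∷ σ) = cong (iverson (b <ᵇ a) ℕ.+_) (des-map-suc (b ∷ σ))

lmaFrom-map-suc : ∀ c σ → lmaFrom (just (suc c)) (map suc σ) ≡ lmaFrom (just c) σ
lmaFrom-map-suc c []      = refl
lmaFrom-map-suc c (x ∷ σ) with c <ᵇ x
... | true  = cong suc (lmaFrom-map-suc x σ)
... | false = lmaFrom-map-suc c σ

lma-map-suc : ∀ σ → lma (map suc σ) ≡ lma σ
lma-map-suc []      = refl
lma-map-suc (x ∷ σ) = cong suc (lmaFrom-map-suc x σ)

rma-map-suc : ∀ σ → rma (map suc σ) ≡ rma σ
rma-map-suc σ = trans (cong lma (sym (reverse-map suc σ))) (lma-map-suc (reverse σ))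

peakAt : ℕ∞ → ℕ → ℕ∞ → Bool
peakAt x b y = (x <∞ fin b) ∧ (y <∞ fin b)

head∞ : List ℕ → ℕ∞
head∞ []      = ∞
head∞ (b ∷ _) = fin b

peaks-cons : ∀ z b t → peaks z ∞ (b ∷ t) ≡ iverson (peakAt z b (head∞ t)) ℕ.+ peaks (fin b) ∞ t
peaks-cons z b []      = refl
peaks-cons z b (c ∷ t) = refl

peakAt-last : ∀ z b → peakAt z b ∞ ≡ false
peakAt-last z b = ∧-zeroʳ (z <∞ fin b)

peakAt-leftHigher : ∀ {a b} y → b ≤ a → peakAt (fin a) b y ≡ false
peakAt-leftHigher {a} {b} y b≤a rewrite <ᵇ≡false {a} {b} b≤a = refl

peaks-bound : ∀ z σ → peaks z ∞ σ ℕ.+ peaks z ∞ σ ≤ length σ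
peaks-bound z []          = z≤n
peaks-bound z (a ∷ [])    rewrite peakAt-last z a = z≤n
peaks-bound z (a ∷ b ∷ t) = twoPeaks (b <ᵇ a) refl (peaks-bound (fin a) (b ∷ t)) (peaks-bound (fin b) t)
  where
  P₁ = peaks (fin a) ∞ (b ∷ t)
  P₂ = peaks (fin b) ∞ t
  P = peaks z ∞ (a ∷ b ∷ t)
  twoPeaks : ∀ B → (b <ᵇ a) ≡ B → P₁ ℕ.+ P₁ ≤ suc (length t) → P₂ ℕ.+ P₂ ≤ length t → P ℕ.+ P ≤ suc (suc (length t))
  twoPeaks false b<ᵇa ih₁ ih₂ rewrite b<ᵇa | ∧-zeroʳ (z <∞ fin a) = m≤n⇒m≤1+n ih₁
  twoPeaks true  b<ᵇa ih₁ ih₂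
    rewrite b<ᵇa | peaks-cons (fin a) b t | peakAt-leftHigher (head∞ t) (<⇒≤ (<ᵇ⇒< b a (Equivalence.from T-≡ b<ᵇa)))
    with z <∞ fin a
  ... | true  = s≤s (subst (_≤ suc (length t)) (sym (+-suc _ _)) (s≤s ih₂))
  ... | false = m≤n⇒m≤1+n (m≤n⇒m≤1+n ih₂)

-- Of the inner slots of a permutation with m peaks, `keep` lie next to a peak and `gain` do not;
-- `first` is 1 when the first entry is a peak, as its left slot is not inner.
record PeakSplit (first m L : ℕ) (s : (ℕ → ℚ) → ℚ) : Set where
  field
    keep gain  : ℕ
    keep+gain  : keep ℕ.+ gain ≡ L
    keep+first : keep ℕ.+ first ≡ m ℕ.+ m
    split      : ∀ h → s h ≡ fromℕ keep *ℚ h m + fromℕ gain *ℚ h (suc m)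

PeakSplit-cong : ∀ {first m L s s′} → (∀ h → s′ h ≡ s h) → PeakSplit first m L s → PeakSplit first m L s′
PeakSplit-cong s′≗s ps = record { PeakSplit ps ; split = λ h → trans (s′≗s h) (PeakSplit.split ps h) }

one-more-keep : ∀ x y k g → x + (fromℕ k *ℚ x + fromℕ g *ℚ y) ≡ fromℕ (suc k) *ℚ x + fromℕ g *ℚ y
one-more-keep x y k g = solve 4 (λ x y k g → x :+ (k :* x :+ g :* y) := (con 1ℚ :+ k) :* x :+ g :* y) refl x y (fromℕ k) (fromℕ g)
  where open +-*-Solver

one-more-gain : ∀ x y k g → y + (fromℕ k *ℚ x + fromℕ g *ℚ y) ≡ fromℕ k *ℚ x + fromℕ (suc g) *ℚ y
one-more-gain x y k g = solve 4 (λ x y k g → y :+ (k :* x :+ g :* y) := k :* x :+ (con 1ℚ :+ g) :* y) refl x y (fromℕ k) (fromℕ g)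
  where open +-*-Solver

PeakSplit-extend : ∀ B₀ B₁ P m′ L {s′} → (B₀ ≡ true → B₁ ≡ false) → m′ ≡ iverson B₁ ℕ.+ P →
  PeakSplit (iverson B₁) m′ L s′ →
  PeakSplit (iverson B₀) (iverson B₀ ℕ.+ m′) (suc L) (λ h → h (suc P) + s′ (λ v → h (iverson B₀ ℕ.+ v)))
PeakSplit-extend true true P m′ L not-both _ _ with () ← not-both refl
PeakSplit-extend true false P .P L _ refl ps = record
  { keep = suc keep ; gain = gain ; keep+gain = cong suc keep+gain
  ; keep+first = cong suc (trans (+-suc keep 0) (trans (cong suc keep+first) (sym (+-suc P P))))
  ; split = λ h → trans (cong (h (suc P) +_) (split (h ∘ suc))) (one-more-keep (h (suc P)) (h (suc (suc P))) keep gain) }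
  where open PeakSplit ps
PeakSplit-extend false true P .(suc P) L _ refl ps = record
  { keep = suc keep ; gain = gain ; keep+gain = cong suc keep+gain
  ; keep+first = trans (sym (+-suc keep 0)) keep+first
  ; split = λ h → trans (cong (h (suc P) +_) (split h)) (one-more-keep (h (suc P)) (h (suc (suc P))) keep gain) }
  where open PeakSplit ps
PeakSplit-extend false false P .P L _ refl ps = record
  { keep = keep ; gain = suc gain ; keep+gain = trans (+-suc keep gain) (cong suc keep+gain)
  ; keep+first = keep+first
  ; split = λ h → trans (cong (h (suc P) +_) (split h)) (one-more-gain (h P) (h (suc P)) keep gain) }
  where open PeakSplit ps

peaks-insert-max : ∀ {N} z a b t → a < N → b < N → peaks z ∞ (a ∷ N ∷ b ∷ t) ≡ suc (peaks (fin b) ∞ t)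
peaks-insert-max {N} z a b t a<N b<N
  rewrite <ᵇ≡false {N} {a} (<⇒≤ a<N) | ∧-zeroʳ (z <∞ fin a) | <ᵇ≡true a<N | <ᵇ≡true b<N
        | peaks-cons (fin N) b t | peakAt-leftHigher (head∞ t) (<⇒≤ b<N) = refl

innerPeaks : ∀ {N} z a t → All (_< N) (a ∷ t) →
  PeakSplit (iverson (peakAt z a (head∞ t))) (peaks z ∞ (a ∷ t)) (length t)
            (λ h → ∑[ σ ∈ innerInsertions N (a ∷ t) ] h (peaks z ∞ σ))
innerPeaks z a [] _ rewrite ∧-zeroʳ (z <∞ fin a) = record
  { keep = 0 ; gain = 0 ; keep+gain = refl ; keep+first = refl
  ; split = λ h → solve 2 (λ x y → con 0ℚ := con 0ℚ :* x :+ con 0ℚ :* y) refl (h 0) (h 1) }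
  where open +-*-Solver
innerPeaks {N} z a (b ∷ t) (a<N ∷ b<N ∷ t<N) =
  PeakSplit-cong movePeak
    (PeakSplit-extend B₀ (peakAt (fin a) b (head∞ t)) (peaks (fin b) ∞ t) (peaks (fin a) ∞ (b ∷ t)) (length t)
                      notBoth (peaks-cons (fin a) b t) (innerPeaks (fin a) b t (b<N ∷ t<N)))
  where
  B₀ = peakAt z a (fin b)
  notBoth : B₀ ≡ true → peakAt (fin a) b (head∞ t) ≡ false
  notBoth a-peak with b <ᵇ a in b<ᵇa
  ... | true  = peakAt-leftHigher (head∞ t) (<⇒≤ (<ᵇ⇒< b a (Equivalence.from T-≡ b<ᵇa)))
  ... | false with () ← trans (sym (∧-zeroʳ (z <∞ fin a))) a-peak
  movePeak : ∀ h → ∑[ σ ∈ innerInsertions N (a ∷ b ∷ t) ] h (peaks z ∞ σ)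
                   ≡ h (suc (peaks (fin b) ∞ t)) + ∑[ σ ∈ innerInsertions N (b ∷ t) ] h (iverson B₀ ℕ.+ peaks (fin a) ∞ σ)
  movePeak h = cong₂ _+_ (cong h (peaks-insert-max z a b t a<N b<N))
    (trans (∑-map (a ∷_) (innerInsertions N (b ∷ t)) _)
      (trans (∑-map (b ∷_) (initialInsertions N t) _) (sym (∑-map (b ∷_) (initialInsertions N t) _))))

M0≡Mt-0∷ : ∀ σ → M0 σ ≡ Mt (0 ∷ σ)
M0≡Mt-0∷ []      = refl
M0≡Mt-0∷ (a ∷ σ) = refl

peaks-snoc-max : ∀ {N} z a t → All (_< N) (a ∷ t) → peaks z ∞ (a ∷ t ++ N ∷ []) ≡ peaks z ∞ (a ∷ t)
peaks-snoc-max {N} z a [] (a<N ∷ [])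
  rewrite <ᵇ≡false {N} {a} (<⇒≤ a<N) | ∧-zeroʳ (z <∞ fin a) | ∧-zeroʳ (a ℕ.<ᵇ N) = refl
peaks-snoc-max z a (b ∷ t) (_ ∷ bt<N) = cong (iverson (peakAt z a (fin b)) ℕ.+_) (peaks-snoc-max (fin a) b t bt<N)

Mt-cons-max : ∀ {N} a t → a < N → Mt (N ∷ a ∷ t) ≡ Mt (a ∷ t)
Mt-cons-max {N} a t a<N = begin
  peaks (fin N) ∞ (a ∷ t)
    ≡⟨ peaks-cons (fin N) a t ⟩
  iverson (peakAt (fin N) a (head∞ t)) ℕ.+ peaks (fin a) ∞ t
    ≡⟨ cong (λ b → iverson b ℕ.+ peaks (fin a) ∞ t) (peakAt-leftHigher (head∞ t) (<⇒≤ a<N)) ⟩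
  peaks (fin a) ∞ t
    ≡⟨ sym (peaks-cons ∞ a t) ⟩
  Mt (a ∷ t) ∎
  where open ≡-Reasoning

peakOp : ℚ → ℕ → (ℕ → ℚ) → ℕ → ℚ
peakOp γ n h m = (γ + fromℕ (m ℕ.+ m)) *ℚ h m + fromℕ (n ∸ (m ℕ.+ m)) *ℚ h (suc m)

PeakSplit-0 : ∀ {m L s} → PeakSplit 0 m L s → ∀ h → s h ≡ fromℕ (m ℕ.+ m) *ℚ h m + fromℕ (L ∸ (m ℕ.+ m)) *ℚ h (suc m)
PeakSplit-0 {m} {L} ps h = trans (split h) (cong₂ (λ k g → fromℕ k *ℚ h m + fromℕ g *ℚ h (suc m)) keep≡ gain≡)
  where
  open PeakSplit ps
  keep≡ : keep ≡ m ℕ.+ m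
  keep≡ = trans (sym (ℕP.+-identityʳ keep)) keep+first
  gain≡ : gain ≡ L ∸ (m ℕ.+ m)
  gain≡ = trans (sym (m+n∸m≡n keep gain)) (cong₂ _∸_ keep+gain keep≡)

∑-insertMax-Mt : ∀ {N} α β (h : ℕ → ℚ) a t → All (_< N) (a ∷ t) →
  ∑[ σ ∈ insertions N (a ∷ t) ] (h (Mt σ) *ℚ minimaWeight α β σ)
    ≡ peakOp (α + β) (length t) h (Mt (a ∷ t)) *ℚ minimaWeight α β (a ∷ t)
∑-insertMax-Mt {N} α β h a t τ<N@(a<N ∷ _) = begin
  ∑ (insertions N τ) f
    ≡⟨ ∑-insertions-split N a t f ⟩
  f (N ∷ τ) + ∑ (innerInsertions N τ) f + f (τ ++ N ∷ [])
    ≡⟨ cong₂ _+_ (cong₂ _+_ (cong₂ _*ℚ_ (cong h (Mt-cons-max a t a<N)) front) inner)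
                 (cong₂ _*ℚ_ (cong h (peaks-snoc-max ∞ a t τ<N)) back) ⟩
  h m *ℚ (α *ℚ w) + (K *ℚ h m + G *ℚ h (suc m)) *ℚ w + h m *ℚ (β *ℚ w)
    ≡⟨ solve 7 (λ hm α β w K G h′ → hm :* (α :* w) :+ (K :* hm :+ G :* h′) :* w :+ hm :* (β :* w)
                                   := ((α :+ β :+ K) :* hm :+ G :* h′) :* w)
             refl (h m) α β w K G (h (suc m)) ⟩
  peakOp (α + β) (length t) h m *ℚ w ∎
  where
  open ≡-Reasoning
  open +-*-Solver
  τ = a ∷ t
  m = Mt τ
  w = minimaWeight α β τ
  K = fromℕ (m ℕ.+ m)
  G = fromℕ (length t ∸ (m ℕ.+ m))
  f : List ℕ → ℚ
  f σ = h (Mt σ) *ℚ minimaWeight α β σ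
  front : minimaWeight α β (N ∷ τ) ≡ α *ℚ w
  front = trans (cong₂ (weight α β) (lmi-cons-max τ τ<N) (rmi-cons-max τ τ<N (λ ())))
                (weight-sucˡ α β (rmi τ) (lmi-positive {τ} (λ ())))
  back : minimaWeight α β (τ ++ N ∷ []) ≡ β *ℚ w
  back = trans (cong₂ (weight α β) (lmi-snoc-max τ τ<N (λ ())) (rmi-snoc-max τ τ<N))
               (weight-sucʳ α β (lmi τ) (rmi-positive {τ} (λ ())))
  inner : ∑ (innerInsertions N τ) f ≡ (K *ℚ h m + G *ℚ h (suc m)) *ℚ w
  inner = begin
    ∑ (innerInsertions N τ) f
      ≡⟨ ∑-cong-All (All.map (λ (lmi≡ , rmi≡) → cong (h _ *ℚ_) (cong₂ (weight α β) lmi≡ rmi≡)) (innerInsertions-lmi-rmi a t τ<N)) ⟩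
    ∑[ σ ∈ innerInsertions N τ ] (h (Mt σ) *ℚ w)
      ≡⟨ ∑-*ʳ (innerInsertions N τ) (λ σ → h (Mt σ)) w ⟩
    ∑[ σ ∈ innerInsertions N τ ] h (Mt σ) *ℚ w
      ≡⟨ cong (_*ℚ w) (PeakSplit-0 (innerPeaks ∞ a t τ<N) h) ⟩
    (K *ℚ h m + G *ℚ h (suc m)) *ℚ w ∎

∑-insertMax-M0 : ∀ {n} γ (h : ℕ → ℚ) τ → All (_< suc n) τ →
  ∑[ σ ∈ insertions (suc n) τ ] (h (M0 σ) *ℚ γ ^ rmi σ) ≡ peakOp γ (length τ) h (M0 τ) *ℚ γ ^ rmi τ
∑-insertMax-M0 {n} γ h τ τ<N = begin
  ∑ (insertions (suc n) τ) f
    ≡⟨ ∑-insertions-initial (suc n) τ f ⟩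
  ∑ (initialInsertions (suc n) τ) f + f (τ ++ suc n ∷ [])
    ≡⟨ cong₂ _+_ initial (cong₂ _*ℚ_ (cong h back) (cong (γ ^_) (rmi-snoc-max τ τ<N))) ⟩
  (K *ℚ h m + G *ℚ h (suc m)) *ℚ v + h m *ℚ (γ *ℚ v)
    ≡⟨ solve 6 (λ hm γ v K G h′ → (K :* hm :+ G :* h′) :* v :+ hm :* (γ :* v) := ((γ :+ K) :* hm :+ G :* h′) :* v)
             refl (h m) γ v K G (h (suc m)) ⟩
  peakOp γ (length τ) h m *ℚ v ∎
  where
  open ≡-Reasoning
  open +-*-Solver
  m = M0 τ
  v = γ ^ rmi τ
  K = fromℕ (m ℕ.+ m)
  G = fromℕ (length τ ∸ (m ℕ.+ m))
  f : List ℕ → ℚ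
  f σ = h (M0 σ) *ℚ γ ^ rmi σ
  0τ<N : All (_< suc n) (0 ∷ τ)
  0τ<N = s≤s z≤n ∷ τ<N
  -- For M₀ the slot in front of τ is an inner slot of 0 ∷ τ.
  initialPeaks : PeakSplit 0 m (length τ) (λ h → ∑[ σ ∈ innerInsertions (suc n) (0 ∷ τ) ] h (Mt σ))
  initialPeaks = subst (λ k → PeakSplit 0 k (length τ) (λ h → ∑[ σ ∈ innerInsertions (suc n) (0 ∷ τ) ] h (Mt σ)))
                       (sym (M0≡Mt-0∷ τ)) (innerPeaks ∞ 0 τ 0τ<N)
  back : M0 (τ ++ suc n ∷ []) ≡ m
  back = trans (M0≡Mt-0∷ (τ ++ suc n ∷ [])) (trans (peaks-snoc-max ∞ 0 τ 0τ<N) (sym (M0≡Mt-0∷ τ)))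
  initial : ∑ (initialInsertions (suc n) τ) f ≡ (K *ℚ h m + G *ℚ h (suc m)) *ℚ v
  initial = begin
    ∑ (initialInsertions (suc n) τ) f
      ≡⟨ ∑-cong-All (All.map (λ rmi≡ → cong (λ r → h _ *ℚ γ ^ r) rmi≡) (initialInsertions-rmi τ τ<N)) ⟩
    ∑[ σ ∈ initialInsertions (suc n) τ ] (h (M0 σ) *ℚ v)
      ≡⟨ ∑-*ʳ (initialInsertions (suc n) τ) (λ σ → h (M0 σ)) v ⟩
    ∑[ σ ∈ initialInsertions (suc n) τ ] h (M0 σ) *ℚ v
      ≡⟨ cong (_*ℚ v) (trans (∑-cong (initialInsertions (suc n) τ) (λ σ → cong h (M0≡Mt-0∷ σ)))
                            (sym (∑-map (0 ∷_) (initialInsertions (suc n) τ) (λ σ → h (Mt σ))))) ⟩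
    ∑[ σ ∈ innerInsertions (suc n) (0 ∷ τ) ] h (Mt σ) *ℚ v
      ≡⟨ cong (_*ℚ v) (PeakSplit-0 initialPeaks h) ⟩
    (K *ℚ h m + G *ℚ h (suc m)) *ℚ v ∎

Mt-transfer : ∀ α β n (h : ℕ → ℚ) →
  ∑[ σ ∈ 𝔖 (suc (suc n)) ] (h (Mt σ) *ℚ minimaWeight α β σ)
    ≡ ∑[ τ ∈ 𝔖 (suc n) ] (peakOp (α + β) n h (Mt τ) *ℚ minimaWeight α β τ)
Mt-transfer α β n h = trans (∑-𝔖-insertMax (suc n) _) (∑-cong-All (All.map insertMax (𝔖-IsPermutation (suc n))))
  where
  insertMax : ∀ {τ} → IsPermutation (suc n) τ →
    ∑[ σ ∈ insertions (suc (suc n)) τ ] (h (Mt σ) *ℚ minimaWeight α β σ) ≡ peakOp (α + β) n h (Mt τ) *ℚ minimaWeight α β τ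
  insertMax {[]}    p with () ← IsPermutation.length≡n p
  insertMax {a ∷ t} p = trans (∑-insertMax-Mt α β h a t (IsPermutation.bounded p))
    (cong (λ k → peakOp (α + β) k h (Mt (a ∷ t)) *ℚ minimaWeight α β (a ∷ t)) (ℕP.suc-injective (IsPermutation.length≡n p)))

M0-transfer : ∀ γ n (h : ℕ → ℚ) →
  ∑[ σ ∈ 𝔖 (suc n) ] (h (M0 σ) *ℚ γ ^ rmi σ) ≡ ∑[ τ ∈ 𝔖 n ] (peakOp γ n h (M0 τ) *ℚ γ ^ rmi τ)
M0-transfer γ n h = trans (∑-𝔖-insertMax n _) (∑-cong-All (All.map insertMax (𝔖-IsPermutation n)))
  where
  insertMax : ∀ {τ} → IsPermutation n τ →
    ∑[ σ ∈ insertions (suc n) τ ] (h (M0 σ) *ℚ γ ^ rmi σ) ≡ peakOp γ n h (M0 τ) *ℚ γ ^ rmi τ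
  insertMax {τ} p = trans (∑-insertMax-M0 γ h τ (IsPermutation.bounded p))
    (cong (λ k → peakOp γ k h (M0 τ) *ℚ γ ^ rmi τ) (IsPermutation.length≡n p))

∑-Mt≡∑-M0 : ∀ α β n (h : ℕ → ℚ) →
  ∑[ σ ∈ 𝔖 (suc n) ] (h (Mt σ) *ℚ minimaWeight α β σ) ≡ ∑[ τ ∈ 𝔖 n ] (h (M0 τ) *ℚ (α + β) ^ rmi τ)
∑-Mt≡∑-M0 α β zero    h = cong (λ w → h 0 *ℚ w + 0ℚ) (*-identityˡ 1ℚ)
∑-Mt≡∑-M0 α β (suc n) h = begin
  ∑[ σ ∈ 𝔖 (suc (suc n)) ] (h (Mt σ) *ℚ minimaWeight α β σ)
    ≡⟨ Mt-transfer α β n h ⟩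
  ∑[ τ ∈ 𝔖 (suc n) ] (peakOp (α + β) n h (Mt τ) *ℚ minimaWeight α β τ)
    ≡⟨ ∑-Mt≡∑-M0 α β n (peakOp (α + β) n h) ⟩
  ∑[ τ ∈ 𝔖 n ] (peakOp (α + β) n h (M0 τ) *ℚ (α + β) ^ rmi τ)
    ≡⟨ sym (M0-transfer (α + β) n h) ⟩
  ∑[ σ ∈ 𝔖 (suc n) ] (h (M0 σ) *ℚ (α + β) ^ rmi σ) ∎
  where open ≡-Reasoning

ascDesOp : ℚ → ℚ → (ℕ → ℕ → ℚ) → ℕ → ℕ → ℚ
ascDesOp α β H a d = (α + fromℕ d) *ℚ H (suc a) d + (β + fromℕ a) *ℚ H a (suc d)

innerSlots : ∀ (B₁ B₂ : Bool) → B₁ ≡ not B₂ → ∀ (H : ℕ → ℕ → ℚ) A D →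
  H (suc A) (suc D) + (fromℕ D *ℚ H (iverson B₁ ℕ.+ suc A) (iverson B₂ ℕ.+ D) + fromℕ A *ℚ H (iverson B₁ ℕ.+ A) (iverson B₂ ℕ.+ suc D))
    ≡ fromℕ (iverson B₂ ℕ.+ D) *ℚ H (suc (iverson B₁ ℕ.+ A)) (iverson B₂ ℕ.+ D)
      + fromℕ (iverson B₁ ℕ.+ A) *ℚ H (iverson B₁ ℕ.+ A) (suc (iverson B₂ ℕ.+ D))
innerSlots .true false refl H A D =
  solve 4 (λ x y Dq Aq → x :+ (Dq :* y :+ Aq :* x) := Dq :* y :+ (con 1ℚ :+ Aq) :* x) refl
    (H (suc A) (suc D)) (H (suc (suc A)) D) (fromℕ D) (fromℕ A)
  where open +-*-Solver
innerSlots .false true refl H A D =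
  solve 4 (λ x y Dq Aq → x :+ (Dq :* x :+ Aq :* y) := (con 1ℚ :+ Dq) :* x :+ Aq :* y) refl
    (H (suc A) (suc D)) (H A (suc (suc D))) (fromℕ D) (fromℕ A)
  where open +-*-Solver

∑-innerInsertions-ascDes : ∀ τ → All (0 <_) τ → Linked _≢_ τ → ∀ (H : ℕ → ℕ → ℚ) →
  ∑[ σ ∈ innerInsertions 0 τ ] H (asc σ) (des σ)
    ≡ fromℕ (des τ) *ℚ H (suc (asc τ)) (des τ) + fromℕ (asc τ) *ℚ H (asc τ) (suc (des τ))
∑-innerInsertions-ascDes []       _ _ H = solve 2 (λ x y → con 0ℚ := con 0ℚ :* x :+ con 0ℚ :* y) refl (H 1 0) (H 0 1)
  where open +-*-Solver
∑-innerInsertions-ascDes (a ∷ []) _ _ H = solve 2 (λ x y → con 0ℚ := con 0ℚ :* x :+ con 0ℚ :* y) refl (H 1 0) (H 0 1)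
  where open +-*-Solver
∑-innerInsertions-ascDes (suc a ∷ suc b ∷ t) (_ ∷ b>0 ∷ t>0) (a≢b ∷ bt≢) H = begin
  H (suc As) (suc Ds) + ∑[ σ ∈ map (suc a ∷_) (innerInsertions 0 (suc b ∷ t)) ] H (asc σ) (des σ)
    ≡⟨ cong (H (suc As) (suc Ds) +_) (trans (∑-map (suc a ∷_) (innerInsertions 0 (suc b ∷ t)) _)
         (trans (∑-map (suc b ∷_) (initialInsertions 0 t) _) (sym (∑-map (suc b ∷_) (initialInsertions 0 t) _)))) ⟩
  H (suc As) (suc Ds) + ∑[ σ ∈ innerInsertions 0 (suc b ∷ t) ] H (iverson (a <ᵇ b) ℕ.+ asc σ) (iverson (b <ᵇ a) ℕ.+ des σ)
    ≡⟨ cong (H (suc As) (suc Ds) +_) (∑-innerInsertions-ascDes (suc b ∷ t) (b>0 ∷ t>0) bt≢ H′) ⟩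
  H (suc As) (suc Ds) + (fromℕ Ds *ℚ H (iverson (a <ᵇ b) ℕ.+ suc As) (iverson (b <ᵇ a) ℕ.+ Ds)
                       + fromℕ As *ℚ H (iverson (a <ᵇ b) ℕ.+ As) (iverson (b <ᵇ a) ℕ.+ suc Ds))
    ≡⟨ innerSlots (a <ᵇ b) (b <ᵇ a) (<ᵇ-flip a≢b) H As Ds ⟩
  fromℕ (des τ) *ℚ H (suc (asc τ)) (des τ) + fromℕ (asc τ) *ℚ H (asc τ) (suc (des τ)) ∎
  where
  open ≡-Reasoning
  τ = suc a ∷ suc b ∷ t
  As = asc (suc b ∷ t)
  Ds = des (suc b ∷ t)
  H′ : ℕ → ℕ → ℚ
  H′ p q = H (iverson (a <ᵇ b) ℕ.+ p) (iverson (b <ᵇ a) ℕ.+ q)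

asc-snoc-min : ∀ τ → asc (τ ++ 0 ∷ []) ≡ asc τ
asc-snoc-min []          = refl
asc-snoc-min (a ∷ [])    = refl
asc-snoc-min (a ∷ b ∷ τ) = cong (iverson (a <ᵇ b) ℕ.+_) (asc-snoc-min (b ∷ τ))

des-snoc-min : ∀ a τ → All (0 <_) (a ∷ τ) → des (a ∷ τ ++ 0 ∷ []) ≡ suc (des (a ∷ τ))
des-snoc-min (suc a) []      _            = refl
des-snoc-min a       (b ∷ τ) (_ ∷ bτ>0) =
  trans (cong (iverson (b <ᵇ a) ℕ.+_) (des-snoc-min b τ bτ>0)) (ℕP.+-suc (iverson (b <ᵇ a)) (des (b ∷ τ)))

∑-insertMin : ∀ α β (H : ℕ → ℕ → ℚ) a t → All (0 <_) (a ∷ t) → Linked _≢_ (a ∷ t) →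
  ∑[ σ ∈ insertions 0 (a ∷ t) ] (H (asc σ) (des σ) *ℚ maximaWeight α β σ)
    ≡ ascDesOp α β H (asc (a ∷ t)) (des (a ∷ t)) *ℚ maximaWeight α β (a ∷ t)
∑-insertMin α β H (suc a) t τ>0@(s≤s z≤n ∷ _) τ≢ = begin
  ∑ (insertions 0 τ) f
    ≡⟨ ∑-insertions-split 0 (suc a) t f ⟩
  f (0 ∷ τ) + ∑ (innerInsertions 0 τ) f + f (τ ++ 0 ∷ [])
    ≡⟨ cong₂ _+_ (cong₂ _+_ (cong (H (suc As) Ds *ℚ_) front) inner)
                 (cong₂ _*ℚ_ (cong₂ H (asc-snoc-min τ) (des-snoc-min (suc a) t τ>0)) back) ⟩
  H (suc As) Ds *ℚ (α *ℚ w) + (fromℕ Ds *ℚ H (suc As) Ds + fromℕ As *ℚ H As (suc Ds)) *ℚ w + H As (suc Ds) *ℚ (β *ℚ w)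
    ≡⟨ solve 7 (λ x y α β w D A → x :* (α :* w) :+ (D :* x :+ A :* y) :* w :+ y :* (β :* w)
                                  := ((α :+ D) :* x :+ (β :+ A) :* y) :* w)
             refl (H (suc As) Ds) (H As (suc Ds)) α β w (fromℕ Ds) (fromℕ As) ⟩
  ascDesOp α β H As Ds *ℚ w ∎
  where
  open ≡-Reasoning
  open +-*-Solver
  τ = suc a ∷ t
  As = asc τ
  Ds = des τ
  w = maximaWeight α β τ
  f : List ℕ → ℚ
  f σ = H (asc σ) (des σ) *ℚ maximaWeight α β σ
  front : maximaWeight α β (0 ∷ τ) ≡ α *ℚ w
  front = trans (cong₂ (weight α β) (lma-cons-min τ τ>0) (rma-cons-min τ (λ ())))
                (weight-sucˡ α β (rma τ) (lma-positive {τ} (λ ())))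
  back : maximaWeight α β (τ ++ 0 ∷ []) ≡ β *ℚ w
  back = trans (cong₂ (weight α β) (lma-snoc-min τ (λ ())) (rma-snoc-min τ τ>0))
               (weight-sucʳ α β (lma τ) (rma-positive {τ} (λ ())))
  inner : ∑ (innerInsertions 0 τ) f ≡ (fromℕ Ds *ℚ H (suc As) Ds + fromℕ As *ℚ H As (suc Ds)) *ℚ w
  inner = begin
    ∑ (innerInsertions 0 τ) f
      ≡⟨ ∑-cong-All (All.map (λ (lma≡ , rma≡) → cong (H _ _ *ℚ_) (cong₂ (weight α β) lma≡ rma≡)) (innerInsertions-lma-rma (suc a) t)) ⟩
    ∑[ σ ∈ innerInsertions 0 τ ] (H (asc σ) (des σ) *ℚ w)
      ≡⟨ ∑-*ʳ (innerInsertions 0 τ) (λ σ → H (asc σ) (des σ)) w ⟩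
    ∑[ σ ∈ innerInsertions 0 τ ] H (asc σ) (des σ) *ℚ w
      ≡⟨ cong (_*ℚ w) (∑-innerInsertions-ascDes τ τ>0 τ≢ H) ⟩
    (fromℕ Ds *ℚ H (suc As) Ds + fromℕ As *ℚ H As (suc Ds)) *ℚ w ∎

ascDes-transfer : ∀ α β n (H : ℕ → ℕ → ℚ) →
  ∑[ σ ∈ 𝔖 (suc (suc n)) ] (H (asc σ) (des σ) *ℚ maximaWeight α β σ)
    ≡ ∑[ τ ∈ 𝔖 (suc n) ] (ascDesOp α β H (asc τ) (des τ) *ℚ maximaWeight α β τ)
ascDes-transfer α β n H = begin
  ∑ (𝔖 (suc (suc n))) f
    ≡⟨ ∑-𝔖-insertMin (suc n) f ⟩
  ∑[ τ ∈ 𝔖 (suc n) ] ∑[ σ ∈ insertions 0 τ ] f (map suc σ)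
    ≡⟨ ∑-cong (𝔖 (suc n)) (λ τ → ∑-cong (insertions 0 τ) f-map-suc) ⟩
  ∑[ τ ∈ 𝔖 (suc n) ] ∑ (insertions 0 τ) f
    ≡⟨ ∑-cong-All (All.map insertMin (𝔖-IsPermutation (suc n))) ⟩
  ∑[ τ ∈ 𝔖 (suc n) ] (ascDesOp α β H (asc τ) (des τ) *ℚ maximaWeight α β τ) ∎
  where
  open ≡-Reasoning
  f : List ℕ → ℚ
  f σ = H (asc σ) (des σ) *ℚ maximaWeight α β σ
  f-map-suc : ∀ σ → f (map suc σ) ≡ f σ
  f-map-suc σ = cong₂ _*ℚ_ (cong₂ H (asc-map-suc σ) (des-map-suc σ)) (cong₂ (weight α β) (lma-map-suc σ) (rma-map-suc σ))
  insertMin : ∀ {τ} → IsPermutation (suc n) τ → ∑ (insertions 0 τ) f ≡ ascDesOp α β H (asc τ) (des τ) *ℚ maximaWeight α β τ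
  insertMin {[]}    p with () ← IsPermutation.length≡n p
  insertMin {a ∷ t} p = ∑-insertMin α β H a t (IsPermutation.positive p) (distinct⇒Linked≢ (a ∷ t) (IsPermutation.injective p))

sumShift : (ℕ → ℕ → ℚ) → ℕ → ℕ → ℚ
sumShift H a d = H (suc a) d + H a (suc d)

-- ⟨ j ∣ H ⟩ = ∑ p_ad H a d  where  ((x+y)/2)^j = ∑ p_ad x^a y^d; shift k accounts for a factor (xy)^k.
⟨_∣_⟩ : ℕ → (ℕ → ℕ → ℚ) → ℚ
⟨ zero  ∣ H ⟩ = H 0 0
⟨ suc j ∣ H ⟩ = ½ *ℚ ⟨ j ∣ sumShift H ⟩

shift : ℕ → (ℕ → ℕ → ℚ) → ℕ → ℕ → ℚ
shift k H a d = H (k ℕ.+ a) (k ℕ.+ d)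

⟨⟩-cong : ∀ j {H G : ℕ → ℕ → ℚ} → (∀ a d → H a d ≡ G a d) → ⟨ j ∣ H ⟩ ≡ ⟨ j ∣ G ⟩
⟨⟩-cong zero    H≗G = H≗G 0 0
⟨⟩-cong (suc j) H≗G = cong (½ *ℚ_) (⟨⟩-cong j (λ a d → cong₂ _+_ (H≗G (suc a) d) (H≗G a (suc d))))

⟨⟩-+ : ∀ j (H G : ℕ → ℕ → ℚ) → ⟨ j ∣ (λ a d → H a d + G a d) ⟩ ≡ ⟨ j ∣ H ⟩ + ⟨ j ∣ G ⟩
⟨⟩-+ zero    H G = refl
⟨⟩-+ (suc j) H G = begin
  ½ *ℚ ⟨ j ∣ sumShift (λ a d → H a d + G a d) ⟩
    ≡⟨ cong (½ *ℚ_) (⟨⟩-cong j (λ a d → swap-middle (H (suc a) d) (G (suc a) d) (H a (suc d)) (G a (suc d)))) ⟩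
  ½ *ℚ ⟨ j ∣ (λ a d → sumShift H a d + sumShift G a d) ⟩
    ≡⟨ cong (½ *ℚ_) (⟨⟩-+ j (sumShift H) (sumShift G)) ⟩
  ½ *ℚ (⟨ j ∣ sumShift H ⟩ + ⟨ j ∣ sumShift G ⟩)
    ≡⟨ *-distribˡ-+ ½ ⟨ j ∣ sumShift H ⟩ ⟨ j ∣ sumShift G ⟩ ⟩
  ⟨ suc j ∣ H ⟩ + ⟨ suc j ∣ G ⟩ ∎
  where
  open ≡-Reasoning
  swap-middle : ∀ p q r s → (p + q) + (r + s) ≡ (p + r) + (q + s)
  swap-middle = solve 4 (λ p q r s → (p :+ q) :+ (r :+ s) := (p :+ r) :+ (q :+ s)) refl
    where open +-*-Solver

⟨⟩-* : ∀ j q (H : ℕ → ℕ → ℚ) → ⟨ j ∣ (λ a d → q *ℚ H a d) ⟩ ≡ q *ℚ ⟨ j ∣ H ⟩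
⟨⟩-* zero    q H = refl
⟨⟩-* (suc j) q H = begin
  ½ *ℚ ⟨ j ∣ sumShift (λ a d → q *ℚ H a d) ⟩
    ≡⟨ cong (½ *ℚ_) (⟨⟩-cong j (λ a d → sym (*-distribˡ-+ q (H (suc a) d) (H a (suc d))))) ⟩
  ½ *ℚ ⟨ j ∣ (λ a d → q *ℚ sumShift H a d) ⟩
    ≡⟨ cong (½ *ℚ_) (⟨⟩-* j q (sumShift H)) ⟩
  ½ *ℚ (q *ℚ ⟨ j ∣ sumShift H ⟩)
    ≡⟨ solve 3 (λ h q x → h :* (q :* x) := q :* (h :* x)) refl ½ q ⟨ j ∣ sumShift H ⟩ ⟩
  q *ℚ (½ *ℚ ⟨ j ∣ sumShift H ⟩) ∎
  where
  open ≡-Reasoning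
  open +-*-Solver

⟨pred⟩-sumShift : ∀ j (G : ℕ → ℕ → ℚ) →
  fromℕ j *ℚ ⟨ pred j ∣ sumShift G ⟩ ≡ (fromℕ j + fromℕ j) *ℚ ⟨ j ∣ G ⟩
⟨pred⟩-sumShift zero    G = solve 2 (λ x y → con 0ℚ :* x := (con 0ℚ :+ con 0ℚ) :* y) refl ⟨ 0 ∣ sumShift G ⟩ (G 0 0)
  where open +-*-Solver
⟨pred⟩-sumShift (suc j) G = solve 2 (λ J x → (con 1ℚ :+ J) :* x := ((con 1ℚ :+ J) :+ (con 1ℚ :+ J)) :* (con ½ :* x)) refl
  (fromℕ j) ⟨ j ∣ sumShift G ⟩
  where open +-*-Solver

sumShift-ascDesOp : ∀ c (H : ℕ → ℕ → ℚ) a d →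
  sumShift (ascDesOp c c H) a d ≡ ascDesOp c c (sumShift H) a d + (1ℚ + 1ℚ) *ℚ H (suc a) (suc d)
sumShift-ascDesOp c H a d =
  solve 7 (λ c A D x y z w → ((c :+ D) :* x :+ (c :+ (con 1ℚ :+ A)) :* y) :+ ((c :+ (con 1ℚ :+ D)) :* y :+ (c :+ A) :* z)
                            := ((c :+ D) :* (x :+ y) :+ (c :+ A) :* (y :+ z)) :+ (con 1ℚ :+ con 1ℚ) :* y)
    refl c (fromℕ a) (fromℕ d) (H (suc (suc a)) d) (H (suc a) (suc d)) (H a (suc (suc d))) (H a d)
  where open +-*-Solver

-- Dual to D(u^j) = 2c u^(j+1) + j xy u^(j-1) for D = c(x+y) + xy(∂ₓ+∂ᵧ) and u = (x+y)/2.
⟨⟩-ascDesOp : ∀ j c (H : ℕ → ℕ → ℚ) →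
  ⟨ j ∣ ascDesOp c c H ⟩ ≡ (c + c) *ℚ ⟨ suc j ∣ H ⟩ + fromℕ j *ℚ ⟨ pred j ∣ shift 1 H ⟩
⟨⟩-ascDesOp zero    c H =
  solve 4 (λ c x y z → (c :+ con 0ℚ) :* x :+ (c :+ con 0ℚ) :* y := (c :+ c) :* (con ½ :* (x :+ y)) :+ con 0ℚ :* z)
    refl c (H 1 0) (H 0 1) (H 1 1)
  where open +-*-Solver
⟨⟩-ascDesOp (suc j) c H = begin
  ½ *ℚ ⟨ j ∣ sumShift (ascDesOp c c H) ⟩
    ≡⟨ cong (½ *ℚ_) (⟨⟩-cong j (sumShift-ascDesOp c H)) ⟩
  ½ *ℚ ⟨ j ∣ (λ a d → ascDesOp c c (sumShift H) a d + 2ℚ *ℚ shift 1 H a d) ⟩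
    ≡⟨ cong (½ *ℚ_) (trans (⟨⟩-+ j (ascDesOp c c (sumShift H)) _)
                          (cong (⟨ j ∣ ascDesOp c c (sumShift H) ⟩ +_) (⟨⟩-* j 2ℚ (shift 1 H)))) ⟩
  ½ *ℚ (⟨ j ∣ ascDesOp c c (sumShift H) ⟩ + 2ℚ *ℚ S₁)
    ≡⟨ cong (λ u → ½ *ℚ (u + 2ℚ *ℚ S₁)) (⟨⟩-ascDesOp j c (sumShift H)) ⟩
  ½ *ℚ ((c + c) *ℚ S + fromℕ j *ℚ ⟨ pred j ∣ sumShift (shift 1 H) ⟩ + 2ℚ *ℚ S₁)
    ≡⟨ cong (λ u → ½ *ℚ ((c + c) *ℚ S + u + 2ℚ *ℚ S₁)) (⟨pred⟩-sumShift j (shift 1 H)) ⟩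
  ½ *ℚ ((c + c) *ℚ S + (fromℕ j + fromℕ j) *ℚ S₁ + 2ℚ *ℚ S₁)
    ≡⟨ solve 4 (λ c J S S₁ → con ½ :* ((c :+ c) :* S :+ (J :+ J) :* S₁ :+ (con 1ℚ :+ con 1ℚ) :* S₁)
                           := (c :+ c) :* (con ½ :* S) :+ (con 1ℚ :+ J) :* S₁) refl c (fromℕ j) S S₁ ⟩
  (c + c) *ℚ ⟨ suc (suc j) ∣ H ⟩ + fromℕ (suc j) *ℚ S₁ ∎
  where
  open ≡-Reasoning
  open +-*-Solver
  2ℚ = 1ℚ + 1ℚ
  S  = ⟨ suc j ∣ sumShift H ⟩
  S₁ = ⟨ j ∣ shift 1 H ⟩

ascDesOp-shift : ∀ c k (H : ℕ → ℕ → ℚ) a d →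
  ascDesOp c c H (k ℕ.+ a) (k ℕ.+ d) ≡ ascDesOp (c + fromℕ k) (c + fromℕ k) (shift k H) a d
ascDesOp-shift c k H a d rewrite fromℕ-+ k a | fromℕ-+ k d | +-suc k a | +-suc k d =
  cong₂ (λ p q → p *ℚ H (suc (k ℕ.+ a)) (k ℕ.+ d) + q *ℚ H (k ℕ.+ a) (suc (k ℕ.+ d)))
        (sym (+-assoc c (fromℕ k) (fromℕ d))) (sym (+-assoc c (fromℕ k) (fromℕ a)))

⟨⟩-peakOp : ∀ c n (H : ℕ → ℕ → ℚ) m → m ℕ.+ m ≤ n →
  ⟨ n ∸ (m ℕ.+ m) ∣ shift m (ascDesOp c c H) ⟩ ≡ peakOp (c + c) n (λ k → ⟨ suc n ∸ (k ℕ.+ k) ∣ shift k H ⟩) m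
⟨⟩-peakOp c n H m 2m≤n = begin
  ⟨ j ∣ shift m (ascDesOp c c H) ⟩
    ≡⟨ ⟨⟩-cong j (ascDesOp-shift c m H) ⟩
  ⟨ j ∣ ascDesOp c′ c′ (shift m H) ⟩
    ≡⟨ ⟨⟩-ascDesOp j c′ (shift m H) ⟩
  (c′ + c′) *ℚ ⟨ suc j ∣ shift m H ⟩ + fromℕ j *ℚ ⟨ pred j ∣ shift 1 (shift m H) ⟩
    ≡⟨ cong₂ (λ γ u → γ *ℚ ⟨ suc j ∣ shift m H ⟩ + fromℕ j *ℚ u)
             c′+c′ (⟨⟩-cong (pred j) (λ a d → cong₂ H (+-suc m a) (+-suc m d))) ⟩
  (c + c + fromℕ (m ℕ.+ m)) *ℚ ⟨ suc j ∣ shift m H ⟩ + fromℕ j *ℚ ⟨ pred j ∣ shift (suc m) H ⟩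
    ≡⟨ cong₂ (λ i i′ → (c + c + fromℕ (m ℕ.+ m)) *ℚ ⟨ i ∣ shift m H ⟩ + fromℕ j *ℚ ⟨ i′ ∣ shift (suc m) H ⟩)
             suc-j pred-j ⟩
  peakOp (c + c) n (λ k → ⟨ suc n ∸ (k ℕ.+ k) ∣ shift k H ⟩) m ∎
  where
  open ≡-Reasoning
  j = n ∸ (m ℕ.+ m)
  c′ = c + fromℕ m
  c′+c′ : c′ + c′ ≡ c + c + fromℕ (m ℕ.+ m)
  c′+c′ = trans (solve 2 (λ c M → (c :+ M) :+ (c :+ M) := c :+ c :+ (M :+ M)) refl c (fromℕ m)) (cong (c + c +_) (sym (fromℕ-+ m m)))
    where open +-*-Solver
  suc-j : suc j ≡ suc n ∸ (m ℕ.+ m)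
  suc-j = sym (ℕP.+-∸-assoc 1 2m≤n)
  pred-j : pred j ≡ suc n ∸ (suc m ℕ.+ suc m)
  pred-j = trans (ℕP.pred[m∸n]≡m∸[1+n] n (m ℕ.+ m)) (cong (n ∸_) (sym (+-suc m m)))

monomial : ℚ → ℚ → ℕ → ℕ → ℚ
monomial x y a d = x ^ a *ℚ y ^ d

⟨⟩-monomial : ∀ x y j → ⟨ j ∣ monomial x y ⟩ ≡ (½ *ℚ (x + y)) ^ j
⟨⟩-monomial x y zero    = *-identityˡ 1ℚ
⟨⟩-monomial x y (suc j) = begin
  ½ *ℚ ⟨ j ∣ sumShift (monomial x y) ⟩
    ≡⟨ cong (½ *ℚ_) (⟨⟩-cong j (λ a d → factor (x ^ a) (y ^ d))) ⟩
  ½ *ℚ ⟨ j ∣ (λ a d → (x + y) *ℚ monomial x y a d) ⟩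
    ≡⟨ cong (½ *ℚ_) (trans (⟨⟩-* j (x + y) (monomial x y)) (cong ((x + y) *ℚ_) (⟨⟩-monomial x y j))) ⟩
  ½ *ℚ ((x + y) *ℚ (½ *ℚ (x + y)) ^ j)
    ≡⟨ sym (*-assoc ½ (x + y) _) ⟩
  (½ *ℚ (x + y)) ^ suc j ∎
  where
  open ≡-Reasoning
  open +-*-Solver
  factor : ∀ X Y → x *ℚ X *ℚ Y + X *ℚ (y *ℚ Y) ≡ (x + y) *ℚ (X *ℚ Y)
  factor = solve 4 (λ x y X Y → x :* X :* Y :+ X :* (y :* Y) := (x :+ y) :* (X :* Y)) refl x y

⟨⟩-shift-monomial : ∀ x y k j → ⟨ j ∣ shift k (monomial x y) ⟩ ≡ (x *ℚ y) ^ k *ℚ (½ *ℚ (x + y)) ^ j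
⟨⟩-shift-monomial x y k j = begin
  ⟨ j ∣ shift k (monomial x y) ⟩                      ≡⟨ ⟨⟩-cong j factor ⟩
  ⟨ j ∣ (λ a d → (x *ℚ y) ^ k *ℚ monomial x y a d) ⟩  ≡⟨ ⟨⟩-* j ((x *ℚ y) ^ k) (monomial x y) ⟩
  (x *ℚ y) ^ k *ℚ ⟨ j ∣ monomial x y ⟩                ≡⟨ cong ((x *ℚ y) ^ k *ℚ_) (⟨⟩-monomial x y j) ⟩
  (x *ℚ y) ^ k *ℚ (½ *ℚ (x + y)) ^ j                  ∎
  where
  open ≡-Reasoning
  factor : ∀ a d → x ^ (k ℕ.+ a) *ℚ y ^ (k ℕ.+ d) ≡ (x *ℚ y) ^ k *ℚ monomial x y a d
  factor a d rewrite ^-+ x k a | ^-+ y k d | ^-distrib-* x y k =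
    solve 4 (λ X Y Xa Yd → X :* Xa :* (Y :* Yd) := X :* Y :* (Xa :* Yd)) refl (x ^ k) (y ^ k) (x ^ a) (y ^ d)
    where open +-*-Solver

M0-bound : ∀ {n τ} → IsPermutation n τ → M0 τ ℕ.+ M0 τ ≤ n
M0-bound {τ = τ} p = subst (M0 τ ℕ.+ M0 τ ≤_) (IsPermutation.length≡n p) (peaks-bound (fin 0) τ)

∑-ascDes≡∑-M0 : ∀ c n (H : ℕ → ℕ → ℚ) →
  ∑[ σ ∈ 𝔖 (suc n) ] (H (asc σ) (des σ) *ℚ maximaWeight c c σ)
    ≡ ∑[ τ ∈ 𝔖 n ] (⟨ n ∸ (M0 τ ℕ.+ M0 τ) ∣ shift (M0 τ) H ⟩ *ℚ (c + c) ^ rmi τ)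
∑-ascDes≡∑-M0 c zero    H = cong (λ w → H 0 0 *ℚ w + 0ℚ) (*-identityˡ 1ℚ)
∑-ascDes≡∑-M0 c (suc n) H = begin
  ∑[ σ ∈ 𝔖 (suc (suc n)) ] (H (asc σ) (des σ) *ℚ maximaWeight c c σ)
    ≡⟨ ascDes-transfer c c n H ⟩
  ∑[ σ ∈ 𝔖 (suc n) ] (ascDesOp c c H (asc σ) (des σ) *ℚ maximaWeight c c σ)
    ≡⟨ ∑-ascDes≡∑-M0 c n (ascDesOp c c H) ⟩
  ∑[ τ ∈ 𝔖 n ] (⟨ n ∸ (M0 τ ℕ.+ M0 τ) ∣ shift (M0 τ) (ascDesOp c c H) ⟩ *ℚ (c + c) ^ rmi τ)
    ≡⟨ ∑-cong-All (All.map (λ {τ} p → cong (_*ℚ (c + c) ^ rmi τ) (⟨⟩-peakOp c n H (M0 τ) (M0-bound p))) (𝔖-IsPermutation n)) ⟩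
  ∑[ τ ∈ 𝔖 n ] (peakOp (c + c) n Φ (M0 τ) *ℚ (c + c) ^ rmi τ)
    ≡⟨ sym (M0-transfer (c + c) n Φ) ⟩
  ∑[ σ ∈ 𝔖 (suc n) ] (Φ (M0 σ) *ℚ (c + c) ^ rmi σ) ∎
  where
  open ≡-Reasoning
  Φ : ℕ → ℚ
  Φ k = ⟨ suc n ∸ (k ℕ.+ k) ∣ shift k H ⟩

M0<suc⌊n/2⌋ : ∀ {n τ} → IsPermutation n τ → M0 τ < suc ⌊ n /2⌋
M0<suc⌊n/2⌋ {n} {τ} p = s≤s (ℕP.≤-trans (ℕP.≤-reflexive (ℕP.n≡⌊n+n/2⌋ (M0 τ))) (ℕP.⌊n/2⌋-mono (M0-bound p)))

peak-identity : ∀ n k α β → ∑ (𝒫 (suc n) k) (minimaWeight α β) ≡ ∑[ τ ∈ ℒ n k ] ((α + β) ^ rmi τ)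
peak-identity n k α β = begin
  ∑ (𝒫 (suc n) k) (minimaWeight α β)                     ≡⟨ ∑-filter-≡ᵇ Mt k (𝔖 (suc n)) _ ⟩
  ∑[ σ ∈ 𝔖 (suc n) ] (δ k (Mt σ) *ℚ minimaWeight α β σ)  ≡⟨ ∑-Mt≡∑-M0 α β n (δ k) ⟩
  ∑[ τ ∈ 𝔖 n ] (δ k (M0 τ) *ℚ (α + β) ^ rmi τ)           ≡⟨ sym (∑-filter-≡ᵇ M0 k (𝔖 n) _) ⟩
  ∑[ τ ∈ ℒ n k ] ((α + β) ^ rmi τ)                       ∎
  where open ≡-Reasoning

γ-expansion : ∀ n x y γ →
  A (suc n) x y (½ *ℚ γ) (½ *ℚ γ)
    ≡ ∑[ k ∈ upTo (suc ⌊ n /2⌋) ] ((x *ℚ y) ^ k *ℚ (½ *ℚ (x + y)) ^ (n ∸ (k ℕ.+ k)) *ℚ ∑[ τ ∈ ℒ n k ] (γ ^ rmi τ))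
γ-expansion n x y γ = begin
  A (suc n) x y c c
    ≡⟨ ∑-cong (𝔖 (suc n)) (λ σ → *-assoc (monomial x y (asc σ) (des σ)) _ _) ⟩
  ∑[ σ ∈ 𝔖 (suc n) ] (monomial x y (asc σ) (des σ) *ℚ maximaWeight c c σ)
    ≡⟨ ∑-ascDes≡∑-M0 c n (monomial x y) ⟩
  ∑[ τ ∈ 𝔖 n ] (⟨ n ∸ (M0 τ ℕ.+ M0 τ) ∣ shift (M0 τ) (monomial x y) ⟩ *ℚ (c + c) ^ rmi τ)
    ≡⟨ ∑-cong (𝔖 n) (λ τ → cong₂ _*ℚ_ (⟨⟩-shift-monomial x y (M0 τ) (n ∸ (M0 τ ℕ.+ M0 τ))) (cong (_^ rmi τ) c+c≡γ)) ⟩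
  ∑[ τ ∈ 𝔖 n ] (Ψ (M0 τ) *ℚ γ ^ rmi τ)
    ≡⟨ ∑-groupBy M0 (suc ⌊ n /2⌋) (𝔖 n) _ Ψ (All.map M0<suc⌊n/2⌋ (𝔖-IsPermutation n)) ⟩
  ∑[ k ∈ upTo (suc ⌊ n /2⌋) ] (Ψ k *ℚ ∑[ τ ∈ ℒ n k ] (γ ^ rmi τ)) ∎
  where
  open ≡-Reasoning
  c = ½ *ℚ γ
  c+c≡γ : c + c ≡ γ
  c+c≡γ = solve 1 (λ γ → con ½ :* γ :+ con ½ :* γ := γ) refl γ
    where open +-*-Solver
  Ψ : ℕ → ℚ
  Ψ k = (x *ℚ y) ^ k *ℚ (½ *ℚ (x + y)) ^ (n ∸ (k ℕ.+ k))

halves-out : ∀ n k x y L →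
  (x *ℚ y) ^ k *ℚ (½ *ℚ (x + y)) ^ (n ∸ (k ℕ.+ k)) *ℚ L
    ≡ (½ ^ (n ∸ 2 * k) *ℚ L) *ℚ ((x *ℚ y) ^ k *ℚ (x + y) ^ (suc n ∸ 2 * k ∸ 1))
halves-out n k x y L = begin
  (x *ℚ y) ^ k *ℚ (½ *ℚ (x + y)) ^ j *ℚ L
    ≡⟨ cong (λ u → (x *ℚ y) ^ k *ℚ u *ℚ L) (^-distrib-* ½ (x + y) j) ⟩
  (x *ℚ y) ^ k *ℚ (½ ^ j *ℚ (x + y) ^ j) *ℚ L
    ≡⟨ solve 4 (λ X h s L → X :* (h :* s) :* L := (h :* L) :* (X :* s)) refl ((x *ℚ y) ^ k) (½ ^ j) ((x + y) ^ j) L ⟩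
  (½ ^ j *ℚ L) *ℚ ((x *ℚ y) ^ k *ℚ (x + y) ^ j)
    ≡⟨ cong₂ (λ i i′ → (½ ^ i *ℚ L) *ℚ ((x *ℚ y) ^ k *ℚ (x + y) ^ i′)) (sym 2k≡) (sym 2k+1≡) ⟩
  (½ ^ (n ∸ 2 * k) *ℚ L) *ℚ ((x *ℚ y) ^ k *ℚ (x + y) ^ (suc n ∸ 2 * k ∸ 1)) ∎
  where
  open ≡-Reasoning
  open +-*-Solver
  j = n ∸ (k ℕ.+ k)
  2k≡ : n ∸ 2 * k ≡ j
  2k≡ = cong (λ i → n ∸ (k ℕ.+ i)) (ℕP.+-identityʳ k)
  2k+1≡ : suc n ∸ 2 * k ∸ 1 ≡ j
  2k+1≡ = trans (ℕP.∸-+-assoc (suc n) (2 * k) 1) (trans (cong (suc n ∸_) (ℕP.+-comm (2 * k) 1)) 2k≡)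

theorem4p2 : (n : ℕ) → 1 ≤ n →
  ((k : ℕ) (α β : ℚ) →
    sumℚ (map (λ σ → (α ^ (lmi σ ∸ 1)) *ℚ (β ^ (rmi σ ∸ 1))) (𝒫 n k))
      ≡ sumℚ (map (λ σ → (α + β) ^ rmi σ) (ℒ (n ∸ 1) k)))
  × ((x y α β : ℚ) →
    A n x y (½ *ℚ (α + β)) (½ *ℚ (α + β))
      ≡ sumℚ (map (λ k → ((½ ^ (n ∸ 1 ∸ 2 * k)) *ℚ sumℚ (map (λ σ → (α + β) ^ rmi σ) (ℒ (n ∸ 1) k)))
                          *ℚ (((x *ℚ y) ^ k) *ℚ ((x + y) ^ (n ∸ 2 * k ∸ 1))))
                  (upTo (suc ⌊ (n ∸ 1) /2⌋))))
theorem4p2 (suc n) _ = peak-identity n , λ x y α β →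
  trans (γ-expansion n x y (α + β)) (∑-cong (upTo (suc ⌊ n /2⌋)) (λ k → halves-out n k x y _))
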